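{- Let $t \ge 2$ be an integer and let $n \ge m$ be positive integers. Then $$\mathrm{ex}\left(n, m, \{C_4, \theta_{3,t}\}\right) \le \sqrt[3]{t-1}\,(mn)^{2/3} + (1+o(1))\,t\,n^{3/4}m^{1/2} + m\sqrt[3]{n} + n,$$ where $o(1)$ tends to $0$ as $n \to \infty$.
   Context: For positive integers $n, m$ and a family $\mathcal{F}$ of graphs, the bipartite Turán number $\mathrm{ex}(n,m,\mathcal{F})$ is the maximum number of edges in a bipartite graph with parts of sizes $m$ and $n$ that contains no graph of $\mathcal{F}$ as a subgraph. $C_4$ is the cycle of length $4$, and $\theta_{3,t}$ is the graph consisting of two vertices joined by $t$ internally vertex-disjoint paths, each of length $3$. -}

module Defs where

open import Data.Nat using (ℕ; zero; suc; _+_)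
open import Data.Fin using (Fin; zero; suc)
open import Data.Bool using (Bool; true; false; if_then_else_)
open import Data.Product using (Σ; _×_; ∃-syntax)
open import Relation.Binary.PropositionalEquality using (_≡_; _≢_)
open import Relation.Nullary using (¬_)
open import Function.Definitions using (Injective)
open import Data.Integer using (+_)
import Data.Rational as ℚ
open ℚ using (ℚ)

-- A bipartite graph with parts A = Fin m and B = Fin n, given by its
-- biadjacency relation (G a b ≡ true iff a ∈ A is adjacent to b ∈ B).
BipGraph : ℕ → ℕ → Set
BipGraph m n = Fin m → Fin n → Bool

Adj : ∀ {m n} → BipGraph m n → Fin m → Fin n → Set
Adj G a b = G a b ≡ true

sumFin : (k : ℕ) → (Fin k → ℕ) → ℕ
sumFin zero    f = 0
sumFin (suc k) f = f zero + sumFin k (λ i → f (suc i))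

edges : ∀ m n → BipGraph m n → ℕ
edges m n G = sumFin m (λ a → sumFin n (λ b → if G a b then 1 else 0))

-- G contains C₄ as a (not necessarily induced) subgraph.  In a bipartite
-- graph a 4-cycle uses two distinct vertices of each part.
ContainsC4 : ∀ {m n} → BipGraph m n → Set
ContainsC4 {m} {n} G =
  ∃[ a₁ ] ∃[ a₂ ] ∃[ b₁ ] ∃[ b₂ ]
    (a₁ ≢ a₂) × (b₁ ≢ b₂) ×
    Adj G a₁ b₁ × Adj G a₁ b₂ × Adj G a₂ b₁ × Adj G a₂ b₂

-- The two branch vertices u, v are at
-- distance 3 along each path, hence lie in opposite parts; w.l.o.g. u ∈ A,
-- v ∈ B, and the i-th path is u – f i – g i – v with f i ∈ B, g i ∈ A.
-- All 2 + 2t vertices are distinct.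
ContainsTheta3 : ∀ {m n} → ℕ → BipGraph m n → Set
ContainsTheta3 {m} {n} t G =
  Σ (Fin m) λ u → Σ (Fin n) λ v →
  Σ (Fin t → Fin n) λ f → Σ (Fin t → Fin m) λ g →
    Injective _≡_ _≡_ f × Injective _≡_ _≡_ g ×
    (∀ i → f i ≢ v) × (∀ i → g i ≢ u) ×
    (∀ i → Adj G u (f i) × Adj G (g i) (f i) × Adj G (g i) v)

ℕtoℚ : ℕ → ℚ
ℕtoℚ k = (+ k) ℚ./ 1

cube : ℚ → ℚ
cube x = x ℚ.* x ℚ.* x

fourth : ℚ → ℚ
fourth x = x ℚ.* x ℚ.* x ℚ.* x

-- The real inequality  e ≤ ∛((t-1)m²n²) + (1+1/k)·t·n^{3/4}·m^{1/2} + m∛n + n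
-- stated without reals: for all nonnegative rationals a, b, c strictly above
-- the three irrational terms (tested via their 3rd/4th powers), e < a+b+c+n.
-- (This is equivalent to the real inequality since ℚ is dense in ℝ.)
BoundHolds : (t k m n e : ℕ) → Set
BoundHolds t k m n e =
  (a b c : ℚ) → ℚ.0ℚ ℚ.≤ a → ℚ.0ℚ ℚ.≤ b → ℚ.0ℚ ℚ.≤ c →
  ℕtoℚ ((t Data.Nat.∸ 1) Data.Nat.* (m Data.Nat.* m) Data.Nat.* (n Data.Nat.* n)) ℚ.< cube a →
  fourth (ℚ.1ℚ ℚ.+ ((+ 1) ℚ./ suc k)) ℚ.* ℕtoℚ (t Data.Nat.^ 4 Data.Nat.* (n Data.Nat.^ 3) Data.Nat.* (m Data.Nat.^ 2))
    ℚ.< fourth b →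
  ℕtoℚ (m Data.Nat.^ 3 Data.Nat.* n) ℚ.< cube c →
  ℕtoℚ e ℚ.< a ℚ.+ b ℚ.+ c ℚ.+ ℕtoℚ n
  where import Data.Nat

-- Write e for the number of edges, d(x) for degrees, ρ = ⌊∛((t − 1)m²n²)⌋, R = ρ + 1
-- and r = ⌊(1 + 1/(k + 1)) t n^{3/4} m^{1/2}⌋. It suffices to find c with c³ ≤ m³n and
-- e ≤ ρ + r + c + n; everything is done in ℕ, and the rational statement only compares
-- ρ, r and c with rationals lying above the three roots.
--
-- As G has no C₄, two vertices of A have at most one common neighbour, so Cauchy–Schwarz
-- over B gives e² ≤ n(e + m²). When m² ≤ t⁴n this alone yields e ≤ n + r.
--
-- Otherwise fix a threshold L. At most (m + n)L edges have an endpoint of degree at most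
-- L; call the others heavy. A heavy edge ab is the middle edge of (d(a) − 1)(d(b) − 1)
-- paths u b a v, and t such paths with the same ends would span a θ₃,ₜ (their inner
-- vertices are distinct as there is no C₄), so these products sum to at most (t − 1)mn.
-- With P = 2nL, AM–GM on each heavy edge gives
--   3(t − 1)mnP ≤ RP(d(a) − 1)(d(b) − 1) + R(t − 1)n(⌊P/(d(a) − 1)⌋ + 1) + R(t − 1)m(⌊P/(d(b) − 1)⌋ + 1),
-- the product of the three terms being at least ((t − 1)mnP)³ because R³ > (t − 1)m²n².
-- Summing, the number e′ of heavy edges satisfies L e′ ≤ (L + 1)R. For L = ⌊2R/r⌋ + 1
-- this gives e ≤ ρ + r + mL + n, and L³ ≤ n once n ≥ 2¹⁶.

module Submission where

open import Defs
open import Data.Nat using (ℕ; suc; _≤_; _≥_)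
open import Data.Product using (Σ)
open import Relation.Nullary using (¬_)

open import Data.Nat hiding (_≟_)
open import Data.Nat.Properties hiding (_≟_)
open import Data.Nat.DivMod using (_%_; m≡m%n+[m/n]*n; m%n<n; m/n*n≤m)
open import Data.Nat.Tactic.RingSolver using (solve)
open import Algebra.Properties.CommutativeSemigroup +-commutativeSemigroup using (x∙yz≈y∙xz)
open import Algebra.Properties.CommutativeSemigroup *-commutativeSemigroup
  using () renaming (x∙yz≈y∙xz to x*[y*z]≡y*[x*z])
open import Algebra.Properties.Semiring.Sum +-*-semiring
  using (sum; sum-syntax; sum-cong-≗; sum-replicate-zero; sum-remove; ∑-comm; ∑-distrib-+; *-distribˡ-sum; *-distribʳ-sum)
open import Data.Bool using (Bool; true; false; if_then_else_; _∧_; not; T)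
open import Data.Bool.Properties using (∧-idem; ∧-conicalˡ; ∧-conicalʳ)
open import Data.Unit using (tt)
open import Data.Fin using (Fin; zero; suc; splitAt; join; _↑ˡ_; _↑ʳ_; inject≤; punchIn)
open import Data.Fin.Properties using (_≟_; join-splitAt; inject≤-injective; punchInᵢ≢i)
open import Data.Product using (∃-syntax; _×_; _,_; proj₁; proj₂)
open import Data.Sum using (inj₁; inj₂; [_,_]′)
open import Data.Empty using (⊥-elim)
open import Data.List using (_∷_; [])
open import Function using (_∘_)
open import Function.Definitions using (Injective)
open import Relation.Binary using (_Preserves_⟶_)
open import Relation.Binary.PropositionalEquality
open import Relation.Nullary using (yes; no; does)
import Data.Nat.Coprimality as Coprime
import Data.Integer as ℤ
import Data.Integer.Properties as ℤ
open import Data.Rational as ℚ using (ℚ; mkℚ; 0ℚ; 1ℚ)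
import Data.Rational.Properties as ℚ
open import Data.Rational.Solver using (module +-*-Solver)
open +-*-Solver using (_:*_; _:=_) renaming (solve to ℚ-solve)

-- Rational form of the bound

ℕtoℚ≡mkℚ : ∀ x → ℕtoℚ x ≡ mkℚ (ℤ.+ x) 0 (Coprime.sym (Coprime.1-coprimeTo x))
ℕtoℚ≡mkℚ x = ℚ.fromℚᵘ-toℚᵘ (mkℚ (ℤ.+ x) 0 (Coprime.sym (Coprime.1-coprimeTo x)))

ℕtoℚ-+ : ∀ a b → ℕtoℚ (a + b) ≡ ℕtoℚ a ℚ.+ ℕtoℚ b
ℕtoℚ-+ a b rewrite ℕtoℚ≡mkℚ a | ℕtoℚ≡mkℚ b =
  cong (ℚ._/ 1) (sym (cong₂ ℤ._+_ (ℤ.*-identityʳ (ℤ.+ a)) (ℤ.*-identityʳ (ℤ.+ b))))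

ℕtoℚ-* : ∀ a b → ℕtoℚ (a * b) ≡ ℕtoℚ a ℚ.* ℕtoℚ b
ℕtoℚ-* a b rewrite ℕtoℚ≡mkℚ a | ℕtoℚ≡mkℚ b = cong (ℚ._/ 1) (ℤ.pos-* a b)

ℕtoℚ-mono-≤ : ∀ {a b} → a ≤ b → ℕtoℚ a ℚ.≤ ℕtoℚ b
ℕtoℚ-mono-≤ {a} {b} a≤b rewrite ℕtoℚ≡mkℚ a | ℕtoℚ≡mkℚ b =
  ℚ.*≤* (subst₂ ℤ._≤_ (sym (ℤ.*-identityʳ (ℤ.+ a))) (sym (ℤ.*-identityʳ (ℤ.+ b))) (ℤ.+≤+ a≤b))

ℕtoℚ-mono-< : ∀ {a b} → a < b → ℕtoℚ a ℚ.< ℕtoℚ b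
ℕtoℚ-mono-< {a} {b} a<b rewrite ℕtoℚ≡mkℚ a | ℕtoℚ≡mkℚ b =
  ℚ.*<* (subst₂ ℤ._<_ (sym (ℤ.*-identityʳ (ℤ.+ a))) (sym (ℤ.*-identityʳ (ℤ.+ b))) (ℤ.+<+ a<b))

ℕtoℚ-cube : ∀ x → ℕtoℚ (x * x * x) ≡ cube (ℕtoℚ x)
ℕtoℚ-cube x = trans (ℕtoℚ-* (x * x) x) (cong (ℚ._* ℕtoℚ x) (ℕtoℚ-* x x))

ℕtoℚ-fourth : ∀ x → ℕtoℚ (x * x * x * x) ≡ fourth (ℕtoℚ x)
ℕtoℚ-fourth x = trans (ℕtoℚ-* (x * x * x) x) (cong (ℚ._* ℕtoℚ x) (ℕtoℚ-cube x))

*-mono-≤-nonNeg : ∀ {p q p′ q′} → 0ℚ ℚ.≤ p → 0ℚ ℚ.≤ q → p ℚ.≤ p′ → q ℚ.≤ q′ → p ℚ.* q ℚ.≤ p′ ℚ.* q′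
*-mono-≤-nonNeg {p} {q} {p′} {q′} 0≤p 0≤q p≤p′ q≤q′ =
  ℚ.≤-trans (ℚ.*-monoʳ-≤-nonNeg q {{ℚ.nonNegative 0≤q}} p≤p′)
            (ℚ.*-monoˡ-≤-nonNeg p′ {{ℚ.nonNegative (ℚ.≤-trans 0≤p p≤p′)}} q≤q′)

*-nonNeg : ∀ {p q} → 0ℚ ℚ.≤ p → 0ℚ ℚ.≤ q → 0ℚ ℚ.≤ p ℚ.* q
*-nonNeg {p} {q} 0≤p 0≤q = ℚ.nonNegative⁻¹ (p ℚ.* q) {{ℚ.nonNeg*nonNeg⇒nonNeg p {{ℚ.nonNegative 0≤p}} q {{ℚ.nonNegative 0≤q}}}}

cube-mono-≤-nonNeg : ∀ {p q} → 0ℚ ℚ.≤ p → p ℚ.≤ q → cube p ℚ.≤ cube q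
cube-mono-≤-nonNeg 0≤p p≤q = *-mono-≤-nonNeg (*-nonNeg 0≤p 0≤p) 0≤p (*-mono-≤-nonNeg 0≤p 0≤p p≤q p≤q) p≤q

fourth-mono-≤-nonNeg : ∀ {p q} → 0ℚ ℚ.≤ p → p ℚ.≤ q → fourth p ℚ.≤ fourth q
fourth-mono-≤-nonNeg 0≤p p≤q = *-mono-≤-nonNeg (*-nonNeg (*-nonNeg 0≤p 0≤p) 0≤p) 0≤p (cube-mono-≤-nonNeg 0≤p p≤q) p≤q

<-of-cube : ∀ {a} x X → 0ℚ ℚ.≤ a → x * x * x ≤ X → ℕtoℚ X ℚ.< cube a → ℕtoℚ x ℚ.< a
<-of-cube {a} x X 0≤a x³≤X X<a³ with ℕtoℚ x ℚ.<? a
... | yes x<a = x<a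
... | no  x≮a = ⊥-elim (ℚ.<-irrefl refl (ℚ.<-≤-trans X<a³ (ℚ.≤-trans (cube-mono-≤-nonNeg 0≤a (ℚ.≮⇒≥ x≮a))
                   (subst (ℚ._≤ ℕtoℚ X) (ℕtoℚ-cube x) (ℕtoℚ-mono-≤ x³≤X)))))

[1+1/K]*K≡K+1 : ∀ k → (1ℚ ℚ.+ (ℤ.+ 1) ℚ./ suc k) ℚ.* ℕtoℚ (suc k) ≡ ℕtoℚ (suc (suc k))
[1+1/K]*K≡K+1 k = begin
  (1ℚ ℚ.+ 1/K) ℚ.* K       ≡⟨ ℚ.*-distribʳ-+ K 1ℚ 1/K ⟩
  1ℚ ℚ.* K ℚ.+ 1/K ℚ.* K   ≡⟨ cong₂ ℚ._+_ (ℚ.*-identityˡ K) 1/K*K≡1 ⟩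
  K ℚ.+ 1ℚ                 ≡⟨ ℕtoℚ-+ (suc k) 1 ⟨
  ℕtoℚ (suc k + 1)         ≡⟨ cong ℕtoℚ (+-comm (suc k) 1) ⟩
  ℕtoℚ (suc (suc k))       ∎
  where
  open ≡-Reasoning
  K = ℕtoℚ (suc k)
  1/K = (ℤ.+ 1) ℚ./ suc k
  1/K*K≡1 : 1/K ℚ.* K ≡ 1ℚ
  1/K*K≡1 rewrite ℚ.fromℚᵘ-toℚᵘ (mkℚ (ℤ.+ 1) k (Coprime.1-coprimeTo (suc k))) | ℕtoℚ≡mkℚ (suc k) =
    ℚ.*-inverseˡ (mkℚ (ℤ.+ suc k) 0 (Coprime.sym (Coprime.1-coprimeTo (suc k))))

-- (r K)⁴ ≤ (K + 1)⁴ Y says r ≤ (1 + 1/K) Y^{1/4}, for K = k + 1.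
<-of-scaled-fourth : ∀ {b} r k Y → 0ℚ ℚ.≤ b →
  (let rK = r * suc k in rK * rK * rK * rK ≤ suc (suc k) * suc (suc k) * suc (suc k) * suc (suc k) * Y) →
  fourth (1ℚ ℚ.+ (ℤ.+ 1) ℚ./ suc k) ℚ.* ℕtoℚ Y ℚ.< fourth b → ℕtoℚ r ℚ.< b
<-of-scaled-fourth {b} r k Y 0≤b [rK]⁴≤[K+1]⁴Y qY<b⁴ with ℕtoℚ r ℚ.<? b
... | yes r<b = r<b
... | no  r≮b = ⊥-elim (ℚ.<-irrefl refl (ℚ.<-≤-trans [K+1]⁴Y<[rK]⁴ (ℕtoℚ-mono-≤ [rK]⁴≤[K+1]⁴Y)))
  where
  open ℚ.≤-Reasoning
  K = ℕtoℚ (suc k)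
  q = 1ℚ ℚ.+ (ℤ.+ 1) ℚ./ suc k
  0<K⁴ : 0ℚ ℚ.< fourth K
  0<K⁴ = subst (0ℚ ℚ.<_) (ℕtoℚ-fourth (suc k)) (ℕtoℚ-mono-< {0} {suc k * suc k * suc k * suc k} z<s)
  [K+1]⁴Y<[rK]⁴ : ℕtoℚ (suc (suc k) * suc (suc k) * suc (suc k) * suc (suc k) * Y)
                  ℚ.< ℕtoℚ (r * suc k * (r * suc k) * (r * suc k) * (r * suc k))
  [K+1]⁴Y<[rK]⁴ = begin-strict
    ℕtoℚ (suc (suc k) * suc (suc k) * suc (suc k) * suc (suc k) * Y)
      ≡⟨ ℕtoℚ-* (suc (suc k) * suc (suc k) * suc (suc k) * suc (suc k)) Y ⟩
    ℕtoℚ (suc (suc k) * suc (suc k) * suc (suc k) * suc (suc k)) ℚ.* ℕtoℚ Y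
      ≡⟨ cong (ℚ._* ℕtoℚ Y) (trans (ℕtoℚ-fourth (suc (suc k))) (cong fourth (sym ([1+1/K]*K≡K+1 k)))) ⟩
    fourth (q ℚ.* K) ℚ.* ℕtoℚ Y
      ≡⟨ ℚ-solve 3 (λ x y z → (x :* z) :* (x :* z) :* (x :* z) :* (x :* z) :* y
                               := (x :* x :* x :* x) :* y :* (z :* z :* z :* z)) refl q (ℕtoℚ Y) K ⟩
    fourth q ℚ.* ℕtoℚ Y ℚ.* fourth K
      <⟨ ℚ.*-monoˡ-<-pos (fourth K) {{ℚ.positive 0<K⁴}} (ℚ.<-≤-trans qY<b⁴ (fourth-mono-≤-nonNeg 0≤b (ℚ.≮⇒≥ r≮b))) ⟩
    fourth (ℕtoℚ r) ℚ.* fourth K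
      ≡⟨ ℚ-solve 2 (λ x z → (x :* x :* x :* x) :* (z :* z :* z :* z)
                             := (x :* z) :* (x :* z) :* (x :* z) :* (x :* z)) refl (ℕtoℚ r) K ⟩
    fourth (ℕtoℚ r ℚ.* K)
      ≡⟨ trans (ℕtoℚ-fourth (r * suc k)) (cong fourth (ℕtoℚ-* r (suc k))) ⟨
    ℕtoℚ (r * suc k * (r * suc k) * (r * suc k) * (r * suc k)) ∎

BoundHolds-intro : ∀ {t k m n e} ρ r c → e ≤ ρ + r + c + n →
  ρ * ρ * ρ ≤ (t ∸ 1) * (m * m) * (n * n) →
  (let rK = r * suc k in rK * rK * rK * rK ≤ suc (suc k) * suc (suc k) * suc (suc k) * suc (suc k) * (t ^ 4 * n ^ 3 * m ^ 2)) →
  c * c * c ≤ m ^ 3 * n →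
  BoundHolds t k m n e
BoundHolds-intro {t} {k} {m} {n} {e} ρ r c e≤ρ+r+c+n ρ³≤X [rK]⁴≤[K+1]⁴Y c³≤m³n a b c′ 0≤a 0≤b 0≤c′ X<a³ qY<b⁴ m³n<c′³ =
  begin-strict
  ℕtoℚ e                                   ≤⟨ ℕtoℚ-mono-≤ e≤ρ+r+c+n ⟩
  ℕtoℚ (ρ + r + c + n)                     ≡⟨ trans (ℕtoℚ-+ (ρ + r + c) n) (cong (ℚ._+ ℕtoℚ n)
                                                (trans (ℕtoℚ-+ (ρ + r) c) (cong (ℚ._+ ℕtoℚ c) (ℕtoℚ-+ ρ r)))) ⟩
  ℕtoℚ ρ ℚ.+ ℕtoℚ r ℚ.+ ℕtoℚ c ℚ.+ ℕtoℚ n   <⟨ ℚ.+-monoˡ-< (ℕtoℚ n) (ℚ.+-mono-< (ℚ.+-mono-< ρ<a r<b) c<c′) ⟩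
  a ℚ.+ b ℚ.+ c′ ℚ.+ ℕtoℚ n                ∎
  where
  open ℚ.≤-Reasoning
  ρ<a = <-of-cube ρ ((t ∸ 1) * (m * m) * (n * n)) 0≤a ρ³≤X X<a³
  r<b = <-of-scaled-fourth r k (t ^ 4 * n ^ 3 * m ^ 2) 0≤b [rK]⁴≤[K+1]⁴Y qY<b⁴
  c<c′ = <-of-cube c (m ^ 3 * n) 0≤c′ c³≤m³n m³n<c′³

open ≤-Reasoning

-- Finite sums

sumFin≡sum : ∀ k (f : Fin k → ℕ) → sumFin k f ≡ sum f
sumFin≡sum zero    f = refl
sumFin≡sum (suc k) f = cong (f zero +_) (sumFin≡sum k (f ∘ suc))

sum-const : ∀ k c → ∑[ i < k ] c ≡ k * c
sum-const zero    c = refl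
sum-const (suc k) c = cong (c +_) (sum-const k c)

sum-zero : ∀ {k} {f : Fin k → ℕ} → (∀ i → f i ≡ 0) → sum f ≡ 0
sum-zero {k} f≡0 = trans (sum-cong-≗ f≡0) (sum-replicate-zero k)

sum-mono-≤ : ∀ {k} {f g : Fin k → ℕ} → (∀ i → f i ≤ g i) → sum f ≤ sum g
sum-mono-≤ {zero}  f≤g = z≤n
sum-mono-≤ {suc k} f≤g = +-mono-≤ (f≤g zero) (sum-mono-≤ (f≤g ∘ suc))

sum≤k*c : ∀ {k c} {f : Fin k → ℕ} → (∀ i → f i ≤ c) → sum f ≤ k * c
sum≤k*c {k} {c} f≤c = ≤-trans (sum-mono-≤ f≤c) (≤-reflexive (sum-const k c))

sum≤f[j]+k*c : ∀ {k c} (f : Fin k → ℕ) (j : Fin k) → (∀ i → i ≢ j → f i ≤ c) → sum f ≤ f j + k * c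
sum≤f[j]+k*c {suc k} {c} f j f≤c = begin
  sum f                    ≡⟨ sum-remove {i = j} f ⟩
  f j + sum (f ∘ punchIn j) ≤⟨ +-monoʳ-≤ (f j) (sum≤k*c (λ i → f≤c _ (punchInᵢ≢i j i))) ⟩
  f j + k * c              ≤⟨ +-monoʳ-≤ (f j) (m≤n+m (k * c) c) ⟩
  f j + suc k * c          ∎

∑-distrib-+₃ : ∀ {k} (f g h : Fin k → ℕ) → ∑[ i < k ] (f i + g i + h i) ≡ sum f + sum g + sum h
∑-distrib-+₃ f g h = trans (∑-distrib-+ (λ i → f i + g i) h) (cong (_+ sum h) (∑-distrib-+ f g))

sum-*-sum : ∀ {k l} (f : Fin k → ℕ) (g : Fin l → ℕ) → sum f * sum g ≡ ∑[ i < k ] ∑[ j < l ] (f i * g j)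
sum-*-sum f g = trans (*-distribʳ-sum (sum g) f) (sum-cong-≗ (λ i → *-distribˡ-sum (f i) g))

2ab≤a²+b² : ∀ a b → 2 * (a * b) ≤ a * a + b * b
2ab≤a²+b² a b = [ ordered , swapped ]′ (≤-total a b)
  where
  ordered : ∀ {a b} → a ≤ b → 2 * (a * b) ≤ a * a + b * b
  ordered {a} a≤b with m≤n⇒∃[o]m+o≡n a≤b
  ... | d , refl = begin
    2 * (a * (a + d))         ≤⟨ m≤m+n _ (d * d) ⟩
    2 * (a * (a + d)) + d * d ≡⟨ solve (a ∷ d ∷ []) ⟩
    a * a + (a + d) * (a + d) ∎
  swapped : b ≤ a → 2 * (a * b) ≤ a * a + b * b
  swapped b≤a = begin
    2 * (a * b) ≡⟨ cong (2 *_) (*-comm a b) ⟩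
    2 * (b * a) ≤⟨ ordered b≤a ⟩
    b * b + a * a ≡⟨ +-comm (b * b) (a * a) ⟩
    a * a + b * b ∎

sum-cauchy-schwarz : ∀ k (f : Fin k → ℕ) → sum f * sum f ≤ k * ∑[ i < k ] (f i * f i)
sum-cauchy-schwarz k f = *-cancelˡ-≤ 2 (begin
  2 * (sum f * sum f)                           ≡⟨ cong (2 *_) (sum-*-sum f f) ⟩
  2 * ∑[ i < k ] ∑[ j < k ] (f i * f j)         ≡⟨ *-distribˡ-sum 2 (λ i → ∑[ j < k ] (f i * f j)) ⟩
  ∑[ i < k ] (2 * ∑[ j < k ] (f i * f j))       ≡⟨ sum-cong-≗ (λ i → *-distribˡ-sum 2 (λ j → f i * f j)) ⟩
  ∑[ i < k ] ∑[ j < k ] (2 * (f i * f j))       ≤⟨ sum-mono-≤ (λ i → sum-mono-≤ (λ j → 2ab≤a²+b² (f i) (f j))) ⟩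
  ∑[ i < k ] ∑[ j < k ] (f i * f i + f j * f j) ≡⟨ sum-cong-≗ (λ i → ∑-distrib-+ (λ _ → f i * f i) (λ j → f j * f j)) ⟩
  ∑[ i < k ] (∑[ j < k ] (f i * f i) + Q)       ≡⟨ ∑-distrib-+ (λ i → ∑[ j < k ] (f i * f i)) (λ _ → Q) ⟩
  ∑[ i < k ] ∑[ j < k ] (f i * f i) + ∑[ i < k ] Q
    ≡⟨ cong₂ _+_ (sum-cong-≗ (λ i → sum-const k (f i * f i))) (sum-const k Q) ⟩
  ∑[ i < k ] (k * (f i * f i)) + k * Q          ≡⟨ cong (_+ k * Q) (*-distribˡ-sum k (λ i → f i * f i)) ⟨
  k * Q + k * Q                                 ≡⟨ cong (k * Q +_) (+-identityʳ (k * Q)) ⟨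
  2 * (k * Q)                                   ∎)
  where Q = ∑[ i < k ] (f i * f i)

-- Counting, and choosing distinct witnesses

𝟙 : Bool → ℕ
𝟙 b = if b then 1 else 0

𝟙≤1 : ∀ b → 𝟙 b ≤ 1
𝟙≤1 true  = ≤-refl
𝟙≤1 false = z≤n

𝟙-∧ : ∀ x y → 𝟙 x * 𝟙 y ≡ 𝟙 (x ∧ y)
𝟙-∧ true  true  = refl
𝟙-∧ true  false = refl
𝟙-∧ false y     = refl

𝟙-mono-≤ : ∀ {x y} → (x ≡ true → y ≡ true) → 𝟙 x ≤ 𝟙 y
𝟙-mono-≤ {true}  x⇒y rewrite x⇒y refl = ≤-refl
𝟙-mono-≤ {false} x⇒y = z≤n

𝟙-*-mono-≤ : ∀ x {u v} → (x ≡ true → u ≤ v) → 𝟙 x * u ≤ 𝟙 x * v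
𝟙-*-mono-≤ true  u≤v = *-monoʳ-≤ 1 (u≤v refl)
𝟙-*-mono-≤ false u≤v = z≤n

𝟙-*-cong : ∀ x {s s′} → (x ≡ true → s ≡ s′) → 𝟙 x * s ≡ 𝟙 x * s′
𝟙-*-cong true  s≡s′ = cong (1 *_) (s≡s′ refl)
𝟙-*-cong false s≡s′ = refl

count : ∀ {k} → (Fin k → Bool) → ℕ
count p = sum (𝟙 ∘ p)

count-*-count : ∀ {k l} (p : Fin k → Bool) (q : Fin l → Bool) →
  count p * count q ≡ ∑[ i < k ] ∑[ j < l ] 𝟙 (p i ∧ q j)
count-*-count p q = trans (sum-*-sum (𝟙 ∘ p) (𝟙 ∘ q)) (sum-cong-≗ (λ i → sum-cong-≗ (λ j → 𝟙-∧ (p i) (q j))))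

not-does-≟ : ∀ {k} {i j : Fin k} → not (does (i ≟ j)) ≡ true → i ≢ j
not-does-≟ {i = i} {j} h with i ≟ j
... | no i≢j = i≢j

count-remove : ∀ {k} (p : Fin k → Bool) (j : Fin k) →
  count p ≡ 𝟙 (p j) + count (λ i → not (does (i ≟ j)) ∧ p i)
count-remove {suc k} p zero    = refl
count-remove {suc k} p (suc j) = trans (cong (𝟙 (p zero) +_) (count-remove (p ∘ suc) j)) (x∙yz≈y∙xz (𝟙 (p zero)) (𝟙 (p (suc j))) _)

count-remove-true : ∀ {k} (p : Fin k → Bool) j → p j ≡ true → count p ∸ 1 ≡ count (λ i → not (does (i ≟ j)) ∧ p i)
count-remove-true p j pj = cong (_∸ 1) (trans (count-remove p j) (cong (λ x → 𝟙 x + count (λ i → not (does (i ≟ j)) ∧ p i)) pj))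

sum-index : ∀ {k} (c : Fin k → ℕ) → Fin (sum c) → Σ (Fin k) (Fin ∘ c)
sum-index {suc k} c j with splitAt (c zero) j
... | inj₁ x = zero , x
... | inj₂ y with sum-index (c ∘ suc) y
...   | i , x = suc i , x

sum-index⁻¹ : ∀ {k} (c : Fin k → ℕ) → Σ (Fin k) (Fin ∘ c) → Fin (sum c)
sum-index⁻¹ {suc k} c (zero  , x) = x ↑ˡ sum (c ∘ suc)
sum-index⁻¹ {suc k} c (suc i , x) = c zero ↑ʳ sum-index⁻¹ (c ∘ suc) (i , x)

sum-index⁻¹-sum-index : ∀ {k} (c : Fin k → ℕ) j → sum-index⁻¹ c (sum-index c j) ≡ j
sum-index⁻¹-sum-index {suc k} c j with splitAt (c zero) j in eq
... | inj₁ x = trans (cong (join _ _) (sym eq)) (join-splitAt (c zero) _ j)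
... | inj₂ y with sum-index (c ∘ suc) y in eq′
...   | i , x = trans (cong (c zero ↑ʳ_) (trans (cong (sum-index⁻¹ (c ∘ suc)) (sym eq′)) (sum-index⁻¹-sum-index (c ∘ suc) y)))
                      (trans (cong (join _ _) (sym eq)) (join-splitAt (c zero) _ j))

sum-index-injective : ∀ {k} (c : Fin k → ℕ) → Injective _≡_ _≡_ (sum-index c)
sum-index-injective c {x} {y} eq =
  trans (sym (sum-index⁻¹-sum-index c x)) (trans (cong (sum-index⁻¹ c) eq) (sum-index⁻¹-sum-index c y))

record Distinct (t : ℕ) {A : Set} (P : A → Set) : Set where
  constructor distinct
  field
    pick           : Fin t → A
    pick-injective : Injective _≡_ _≡_ pick
    pick-holds     : ∀ j → P (pick j)

Distinct-≤ : ∀ {A : Set} {P : A → Set} {c t} → t ≤ c → Distinct c P → Distinct t P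
Distinct-≤ t≤c (distinct h h-inj h-P) =
  distinct (h ∘ (λ j → inject≤ j t≤c)) (λ eq → inject≤-injective t≤c t≤c _ _ (h-inj eq)) (λ j → h-P _)

Distinct-< : ∀ {A : Set} {P : A → Set} {c t} → Distinct c P → ¬ Distinct t P → c < t
Distinct-< {c = c} {t} dc ¬dt with t ≤? c
... | yes t≤c = ⊥-elim (¬dt (Distinct-≤ t≤c dc))
... | no  t≰c = ≰⇒> t≰c

Fin-𝟙-irrelevant : ∀ {b} (x y : Fin (𝟙 b)) → x ≡ y
Fin-𝟙-irrelevant {true} zero zero = refl

Fin-𝟙-true : ∀ {b} → Fin (𝟙 b) → b ≡ true
Fin-𝟙-true {true} _ = refl

select : ∀ {k} (p : Fin k → Bool) → Distinct (count p) (λ i → p i ≡ true)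
select p = distinct (proj₁ ∘ index) index-injective (Fin-𝟙-true ∘ proj₂ ∘ index)
  where
  index = sum-index (𝟙 ∘ p)
  index-injective : Injective _≡_ _≡_ (proj₁ ∘ index)
  index-injective {x} {y} eq = sum-index-injective (𝟙 ∘ p) (fibre-irrelevant (index x) (index y) eq)
    where
    fibre-irrelevant : ∀ s s′ → proj₁ s ≡ proj₁ s′ → s ≡ s′
    fibre-irrelevant (i , u) (.i , v) refl = cong (i ,_) (Fin-𝟙-irrelevant u v)

select₂ : ∀ {m n} (p : Fin m → Fin n → Bool) →
  Distinct (∑[ a < m ] count (p a)) (λ (a , b) → p a b ≡ true)
select₂ {m} {n} p = distinct (pair ∘ index) pair-injective (λ j → Distinct.pick-holds (select (p _)) (proj₂ (index j)))
  where
  index = sum-index (λ a → count (p a))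
  pair : Σ (Fin m) (λ a → Fin (count (p a))) → Fin m × Fin n
  pair (a , i) = a , Distinct.pick (select (p a)) i
  pair-injective : Injective _≡_ _≡_ (pair ∘ index)
  pair-injective {x} {y} eq = sum-index-injective _ (injective-on-fibres (index x) (index y) eq)
    where
    injective-on-fibres : ∀ s s′ → pair s ≡ pair s′ → s ≡ s′
    injective-on-fibres (a , i) (a′ , j) eq with cong proj₁ eq
    ... | refl = cong (a ,_) (Distinct.pick-injective (select (p a)) (cong proj₂ eq))

-- Inequalities in ℕ

3e₂≤e₁² : ∀ a b c → 3 * (a * b + b * c + c * a) ≤ (a + b + c) * (a + b + c)
3e₂≤e₁² a b c = *-cancelˡ-≤ 2 (begin
  2 * (3 * (a * b + b * c + c * a))                                     ≡⟨ solve (a ∷ b ∷ c ∷ []) ⟩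
  4 * (a * b + b * c + c * a) + (2 * (a * b) + 2 * (b * c) + 2 * (c * a))
    ≤⟨ +-monoʳ-≤ (4 * (a * b + b * c + c * a)) (+-mono-≤ (+-mono-≤ (2ab≤a²+b² a b) (2ab≤a²+b² b c)) (2ab≤a²+b² c a)) ⟩
  4 * (a * b + b * c + c * a) + ((a * a + b * b) + (b * b + c * c) + (c * c + a * a)) ≡⟨ solve (a ∷ b ∷ c ∷ []) ⟩
  2 * ((a + b + c) * (a + b + c))                                                 ∎)

9e₃≤e₁e₂ : ∀ a b c → 9 * (a * b * c) ≤ (a + b + c) * (a * b + b * c + c * a)
9e₃≤e₁e₂ a b c = begin
  9 * (a * b * c)                                                       ≡⟨ solve (a ∷ b ∷ c ∷ []) ⟩
  3 * (a * b * c) + (a * (2 * (b * c)) + b * (2 * (c * a)) + c * (2 * (a * b)))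
    ≤⟨ +-monoʳ-≤ (3 * (a * b * c)) (+-mono-≤ (+-mono-≤ (*-monoʳ-≤ a (2ab≤a²+b² b c)) (*-monoʳ-≤ b (2ab≤a²+b² c a)))
                                              (*-monoʳ-≤ c (2ab≤a²+b² a b))) ⟩
  3 * (a * b * c) + (a * (b * b + c * c) + b * (c * c + a * a) + c * (a * a + b * b)) ≡⟨ solve (a ∷ b ∷ c ∷ []) ⟩
  (a + b + c) * (a * b + b * c + c * a)                                 ∎

amgm₃ : ∀ a b c → 27 * (a * b * c) ≤ (a + b + c) * (a + b + c) * (a + b + c)
amgm₃ a b c = begin
  27 * (a * b * c)                                  ≡⟨ *-assoc 3 9 (a * b * c) ⟩
  3 * (9 * (a * b * c))                             ≤⟨ *-monoʳ-≤ 3 (9e₃≤e₁e₂ a b c) ⟩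
  3 * ((a + b + c) * (a * b + b * c + c * a))       ≡⟨ solve (a ∷ b ∷ c ∷ []) ⟩
  (a + b + c) * (3 * (a * b + b * c + c * a))       ≤⟨ *-monoʳ-≤ (a + b + c) (3e₂≤e₁² a b c) ⟩
  (a + b + c) * ((a + b + c) * (a + b + c))         ≡⟨ *-assoc (a + b + c) _ _ ⟨
  (a + b + c) * (a + b + c) * (a + b + c)           ∎

mono-cancel-< : (f : ℕ → ℕ) → f Preserves _≤_ ⟶ _≤_ → ∀ {x y} → f x < f y → x < y
mono-cancel-< f f-mono {x} {y} fx<fy with x <? y
... | yes x<y = x<y
... | no  x≮y = ⊥-elim (<⇒≱ fx<fy (f-mono (≮⇒≥ x≮y)))

strictMono-cancel-≤ : (f : ℕ → ℕ) → f Preserves _<_ ⟶ _<_ → ∀ {x y} → f x ≤ f y → x ≤ y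
strictMono-cancel-≤ f f-mono {x} {y} fx≤fy with x ≤? y
... | yes x≤y = x≤y
... | no  x≰y = ⊥-elim (<⇒≱ (f-mono (≰⇒> x≰y)) fx≤fy)

square-mono-≤ : (λ x → x * x) Preserves _≤_ ⟶ _≤_
square-mono-≤ x≤y = *-mono-≤ x≤y x≤y

cube-mono-≤ : (λ x → x * x * x) Preserves _≤_ ⟶ _≤_
cube-mono-≤ x≤y = *-mono-≤ (*-mono-≤ x≤y x≤y) x≤y

cube-mono-< : (λ x → x * x * x) Preserves _<_ ⟶ _<_
cube-mono-< x<y = *-mono-< (*-mono-< x<y x<y) x<y

fourth-mono-≤ : (λ x → x * x * (x * x)) Preserves _≤_ ⟶ _≤_
fourth-mono-≤ x≤y = *-mono-≤ (square-mono-≤ x≤y) (square-mono-≤ x≤y)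

fourth-mono-< : (λ x → x * x * (x * x)) Preserves _<_ ⟶ _<_
fourth-mono-< x<y = *-mono-< (*-mono-< x<y x<y) (*-mono-< x<y x<y)

amgm₃-root : ∀ a b c {d} → d * d * d ≤ a * b * c → 3 * d ≤ a + b + c
amgm₃-root a b c {d} d³≤abc = strictMono-cancel-≤ (λ x → x * x * x) cube-mono-< (begin
  3 * d * (3 * d) * (3 * d)                ≡⟨ solve (d ∷ []) ⟩
  27 * (d * d * d)                         ≤⟨ *-monoʳ-≤ 27 d³≤abc ⟩
  27 * (a * b * c)                         ≤⟨ amgm₃ a b c ⟩
  (a + b + c) * (a + b + c) * (a + b + c)  ∎)

root-bracket : (f : ℕ → ℕ) (z : ℕ) → f 0 ≤ z → (∀ x → x ≤ f x) → ∃[ r ] f r ≤ z × z < f (suc r)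
root-bracket f z f0≤z x≤fx = search (suc z) 0 f0≤z (≤-trans (n<1+n z) (x≤fx (suc z)))
  where
  search : ∀ fuel r → f r ≤ z → z < f (r + fuel) → ∃[ r ] f r ≤ z × z < f (suc r)
  search zero r fr≤z z<fr = ⊥-elim (<⇒≱ (subst (λ x → z < f x) (+-identityʳ r) z<fr) fr≤z)
  search (suc fuel) r fr≤z z<f[r+fuel] with z <? f (suc r)
  ... | yes z<f[1+r] = r , fr≤z , z<f[1+r]
  ... | no  z≮f[1+r] = search fuel (suc r) (≮⇒≥ z≮f[1+r]) (subst (λ x → z < f x) (+-suc r fuel) z<f[r+fuel])

-- ⌊p / x⌋, with the junk value 0 at x = 0, where it never matters.
_/₀_ : ℕ → ℕ → ℕ
p /₀ zero  = 0
p /₀ suc x = p / suc x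

*-/₀-≤ : ∀ p x → x * (p /₀ x) ≤ p
*-/₀-≤ p zero    = z≤n
*-/₀-≤ p (suc x) = subst (_≤ p) (*-comm (p / suc x) (suc x)) (m/n*n≤m p (suc x))

≤-*-suc-/₀ : ∀ p {x} → 1 ≤ x → p ≤ x * suc (p /₀ x)
≤-*-suc-/₀ p {suc x} _ = begin
  p                               ≡⟨ m≡m%n+[m/n]*n p (suc x) ⟩
  p % suc x + (p / suc x) * suc x ≤⟨ +-monoˡ-≤ _ (<⇒≤ (m%n<n p (suc x))) ⟩
  suc x + (p / suc x) * suc x     ≡⟨ *-comm (suc (p / suc x)) (suc x) ⟩
  suc x * suc (p / suc x)         ∎

/-bracket : ∀ a r .{{_ : NonZero r}} → a / r * r ≤ a × a < suc (a / r) * r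
/-bracket a r = m/n*n≤m a r , (begin-strict
  a                      ≡⟨ m≡m%n+[m/n]*n a r ⟩
  a % r + a / r * r      <⟨ +-monoˡ-< (a / r * r) (m%n<n a r) ⟩
  r + a / r * r          ∎)

<ᵇ-true⇒< : ∀ {x y} → (x <ᵇ y) ≡ true → x < y
<ᵇ-true⇒< {x} {y} x<ᵇy = <ᵇ⇒< x y (subst T (sym x<ᵇy) tt)

<ᵇ-false⇒≥ : ∀ {x y} → (x <ᵇ y) ≡ false → y ≤ x
<ᵇ-false⇒≥ x≮ᵇy = ≮⇒≥ (λ x<y → subst T x≮ᵇy (<⇒<ᵇ x<y))

-- Degrees, sums over edges, and the C₄-free bound

degA : ∀ {m n} → BipGraph m n → Fin m → ℕ
degA G a = count (G a)

degB : ∀ {m n} → BipGraph m n → Fin n → ℕ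
degB G b = count (λ a → G a b)

transpose : ∀ {m n} → BipGraph m n → BipGraph n m
transpose G b a = G a b

_⊆_ : ∀ {m n} → BipGraph m n → BipGraph m n → Set
H ⊆ G = ∀ a b → H a b ≡ true → G a b ≡ true

edges≡∑degA : ∀ {m n} (G : BipGraph m n) → edges m n G ≡ ∑[ a < m ] degA G a
edges≡∑degA {m} {n} G =
  trans (sumFin≡sum m (λ a → sumFin n (λ b → 𝟙 (G a b)))) (sum-cong-≗ (λ a → sumFin≡sum n (λ b → 𝟙 (G a b))))

edges≡∑degB : ∀ {m n} (G : BipGraph m n) → edges m n G ≡ ∑[ b < n ] degB G b
edges≡∑degB G = trans (edges≡∑degA G) (∑-comm (λ a b → 𝟙 (G a b)))

edges-transpose : ∀ {m n} (G : BipGraph m n) → edges n m (transpose G) ≡ edges m n G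
edges-transpose G = trans (edges≡∑degA (transpose G)) (sym (edges≡∑degB G))

edges≤m*n : ∀ {m n} (G : BipGraph m n) → edges m n G ≤ m * n
edges≤m*n {m} {n} G = subst (_≤ m * n) (sym (edges≡∑degA G))
  (sum≤k*c (λ a → subst (degA G a ≤_) (*-identityʳ n) (sum≤k*c (λ b → 𝟙≤1 (G a b)))))

edgeSum : ∀ {m n} → BipGraph m n → (Fin m → Fin n → ℕ) → ℕ
edgeSum {m} {n} G w = ∑[ a < m ] ∑[ b < n ] (𝟙 (G a b) * w a b)

edgeSum-mono-≤ : ∀ {m n} (G : BipGraph m n) {w w′ : Fin m → Fin n → ℕ} →
  (∀ a b → G a b ≡ true → w a b ≤ w′ a b) → edgeSum G w ≤ edgeSum G w′
edgeSum-mono-≤ G w≤w′ = sum-mono-≤ (λ a → sum-mono-≤ (λ b → 𝟙-*-mono-≤ (G a b) (w≤w′ a b)))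

edgeSum-⊆ : ∀ {m n} {H G : BipGraph m n} (w : Fin m → Fin n → ℕ) → H ⊆ G → edgeSum H w ≤ edgeSum G w
edgeSum-⊆ w H⊆G = sum-mono-≤ (λ a → sum-mono-≤ (λ b → *-monoˡ-≤ (w a b) (𝟙-mono-≤ (H⊆G a b))))

edgeSum-+ : ∀ {m n} (G : BipGraph m n) (u v : Fin m → Fin n → ℕ) →
  edgeSum G (λ a b → u a b + v a b) ≡ edgeSum G u + edgeSum G v
edgeSum-+ {m} {n} G u v = begin-equality
  ∑[ a < m ] ∑[ b < n ] (𝟙 (G a b) * (u a b + v a b))
    ≡⟨ sum-cong-≗ (λ a → sum-cong-≗ (λ b → *-distribˡ-+ (𝟙 (G a b)) (u a b) (v a b))) ⟩
  ∑[ a < m ] ∑[ b < n ] (𝟙 (G a b) * u a b + 𝟙 (G a b) * v a b)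
    ≡⟨ sum-cong-≗ (λ a → ∑-distrib-+ (λ b → 𝟙 (G a b) * u a b) (λ b → 𝟙 (G a b) * v a b)) ⟩
  ∑[ a < m ] (∑[ b < n ] (𝟙 (G a b) * u a b) + ∑[ b < n ] (𝟙 (G a b) * v a b))
    ≡⟨ ∑-distrib-+ (λ a → ∑[ b < n ] (𝟙 (G a b) * u a b)) (λ a → ∑[ b < n ] (𝟙 (G a b) * v a b)) ⟩
  edgeSum G u + edgeSum G v ∎

edgeSum-*ˡ : ∀ {m n} (G : BipGraph m n) c (w : Fin m → Fin n → ℕ) → edgeSum G (λ a b → c * w a b) ≡ c * edgeSum G w
edgeSum-*ˡ {m} {n} G c w = begin-equality
  ∑[ a < m ] ∑[ b < n ] (𝟙 (G a b) * (c * w a b))  ≡⟨ sum-cong-≗ (λ a → sum-cong-≗ (λ b → x*[y*z]≡y*[x*z] (𝟙 (G a b)) c (w a b))) ⟩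
  ∑[ a < m ] ∑[ b < n ] (c * (𝟙 (G a b) * w a b))  ≡⟨ sum-cong-≗ (λ a → *-distribˡ-sum c (λ b → 𝟙 (G a b) * w a b)) ⟨
  ∑[ a < m ] (c * ∑[ b < n ] (𝟙 (G a b) * w a b))  ≡⟨ *-distribˡ-sum c (λ a → ∑[ b < n ] (𝟙 (G a b) * w a b)) ⟨
  c * edgeSum G w                                   ∎

edgeSum-vertex : ∀ {m n} (G : BipGraph m n) (w : Fin m → ℕ) → edgeSum G (λ a _ → w a) ≡ ∑[ a < m ] (degA G a * w a)
edgeSum-vertex G w = sum-cong-≗ (λ a → sym (*-distribʳ-sum (w a) (λ b → 𝟙 (G a b))))

edgeSum-const : ∀ {m n} (G : BipGraph m n) c → edgeSum G (λ _ _ → c) ≡ edges m n G * c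
edgeSum-const {m} {n} G c = begin-equality
  edgeSum G (λ _ _ → c)       ≡⟨ edgeSum-vertex G (λ _ → c) ⟩
  ∑[ a < m ] (degA G a * c)   ≡⟨ *-distribʳ-sum c (degA G) ⟨
  ∑[ a < m ] degA G a * c     ≡⟨ cong (_* c) (edges≡∑degA G) ⟨
  edges m n G * c             ∎

edgeSum-transpose : ∀ {m n} (G : BipGraph m n) (w : Fin m → Fin n → ℕ) →
  edgeSum (transpose G) (λ b a → w a b) ≡ edgeSum G w
edgeSum-transpose G w = ∑-comm (λ b a → 𝟙 (G a b) * w a b)

codegree : ∀ {m n} → BipGraph m n → Fin m → Fin m → ℕ
codegree G a a′ = count (λ b → G a b ∧ G a′ b)

codegree-≤1 : ∀ {m n} {G : BipGraph m n} → ¬ ContainsC4 G → ∀ {a a′} → a′ ≢ a → codegree G a a′ ≤ 1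
codegree-≤1 {G = G} noC4 {a} {a′} a′≢a = ≤-pred (Distinct-< (select (λ b → G a b ∧ G a′ b)) two-common)
  where
  two-common : ¬ Distinct 2 (λ b → (G a b ∧ G a′ b) ≡ true)
  two-common (distinct h h-inj h-common) =
    noC4 (a , a′ , h zero , h (suc zero) , a′≢a ∘ sym , (λ ()) ∘ h-inj ,
          ∧-conicalˡ _ _ (h-common zero) , ∧-conicalˡ _ _ (h-common (suc zero)) ,
          ∧-conicalʳ _ _ (h-common zero) , ∧-conicalʳ _ _ (h-common (suc zero)))

∑degB²≡∑codegree : ∀ {m n} (G : BipGraph m n) →
  ∑[ b < n ] (degB G b * degB G b) ≡ ∑[ a < m ] ∑[ a′ < m ] codegree G a a′
∑degB²≡∑codegree {m} {n} G = begin-equality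
  ∑[ b < n ] (degB G b * degB G b)                          ≡⟨ sum-cong-≗ (λ b → count-*-count (λ a → G a b) (λ a → G a b)) ⟩
  ∑[ b < n ] ∑[ a < m ] ∑[ a′ < m ] 𝟙 (G a b ∧ G a′ b)      ≡⟨ ∑-comm (λ a b → ∑[ a′ < m ] 𝟙 (G a b ∧ G a′ b)) ⟨
  ∑[ a < m ] ∑[ b < n ] ∑[ a′ < m ] 𝟙 (G a b ∧ G a′ b)      ≡⟨ sum-cong-≗ (λ a → ∑-comm (λ b a′ → 𝟙 (G a b ∧ G a′ b))) ⟩
  ∑[ a < m ] ∑[ a′ < m ] codegree G a a′                    ∎

C4-free⇒edges² : ∀ {m n} (G : BipGraph m n) → ¬ ContainsC4 G → edges m n G * edges m n G ≤ n * (edges m n G + m * m)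
C4-free⇒edges² {m} {n} G noC4 = begin
  e * e                                      ≡⟨ cong₂ _*_ (edges≡∑degB G) (edges≡∑degB G) ⟩
  sum (degB G) * sum (degB G)                ≤⟨ sum-cauchy-schwarz n (degB G) ⟩
  n * ∑[ b < n ] (degB G b * degB G b)       ≡⟨ cong (n *_) (∑degB²≡∑codegree G) ⟩
  n * ∑[ a < m ] ∑[ a′ < m ] codegree G a a′ ≤⟨ *-monoʳ-≤ n (sum-mono-≤ row-bound) ⟩
  n * ∑[ a < m ] (degA G a + m * 1)          ≡⟨ cong (n *_) (∑-distrib-+ (degA G) (λ _ → m * 1)) ⟩
  n * (sum (degA G) + ∑[ a < m ] (m * 1))
    ≡⟨ cong (n *_) (cong₂ _+_ (sym (edges≡∑degA G)) (trans (sum-const m (m * 1)) (cong (m *_) (*-identityʳ m)))) ⟩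
  n * (e + m * m)                            ∎
  where
  e = edges m n G
  row-bound : ∀ a → ∑[ a′ < m ] codegree G a a′ ≤ degA G a + m * 1
  row-bound a = subst (λ d → sum (codegree G a) ≤ d + m * 1) (sum-cong-≗ (λ b → cong 𝟙 (∧-idem (G a b))))
                  (sum≤f[j]+k*c (codegree G a) a (λ a′ a′≢a → codegree-≤1 noC4 a′≢a))

-- Paths of length three

path : ∀ {m n} → BipGraph m n → Fin m → Fin n → Fin m → Fin n → Bool
path G u v a b = G a b ∧ ((not (does (v ≟ b)) ∧ G a v) ∧ (not (does (u ≟ a)) ∧ G u b))

pathCount : ∀ {m n} → BipGraph m n → Fin m → Fin n → ℕ
pathCount {m} G u v = ∑[ a < m ] count (path G u v a)

record IsPath {m n} (G : BipGraph m n) (u : Fin m) (v : Fin n) (a : Fin m) (b : Fin n) : Set where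
  field
    u~b : Adj G u b
    a~b : Adj G a b
    a~v : Adj G a v
    u≢a : u ≢ a
    v≢b : v ≢ b

path-sound : ∀ {m n} {G : BipGraph m n} {u v a b} → path G u v a b ≡ true → IsPath G u v a b
path-sound {G = G} {u} {v} {a} {b} h = record
  { u~b = ∧-conicalʳ (not (does (u ≟ a))) (G u b) u-part
  ; a~b = ∧-conicalˡ (G a b) _ h
  ; a~v = ∧-conicalʳ (not (does (v ≟ b))) (G a v) v-part
  ; u≢a = not-does-≟ (∧-conicalˡ _ (G u b) u-part)
  ; v≢b = not-does-≟ (∧-conicalˡ _ (G a v) v-part)
  }
  where
  v-part = ∧-conicalˡ (not (does (v ≟ b)) ∧ G a v) (not (does (u ≟ a)) ∧ G u b) (∧-conicalʳ (G a b) _ h)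
  u-part = ∧-conicalʳ (not (does (v ≟ b)) ∧ G a v) (not (does (u ≟ a)) ∧ G u b) (∧-conicalʳ (G a b) _ h)

paths⇒θ : ∀ {m n t} {G : BipGraph m n} u v → ¬ ContainsC4 G →
  Distinct t (λ (a , b) → path G u v a b ≡ true) → ContainsTheta3 t G
paths⇒θ {G = G} u v noC4 (distinct h h-inj h-path) =
  u , v , f , g , f-injective , g-injective , (≢-sym ∘ v≢b ∘ P) , (≢-sym ∘ u≢a ∘ P) , (λ i → u~b (P i) , a~b (P i) , a~v (P i))
  where
  open IsPath
  g = proj₁ ∘ h
  f = proj₂ ∘ h
  P : ∀ i → IsPath G u v (g i) (f i)
  P i = path-sound (h-path i)
  f-injective : Injective _≡_ _≡_ f
  f-injective {i} {j} fi≡fj with g i ≟ g j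
  ... | yes gi≡gj = h-inj (cong₂ _,_ gi≡gj fi≡fj)
  ... | no  gi≢gj = ⊥-elim (noC4 (g i , g j , f i , v , gi≢gj , ≢-sym (v≢b (P i)) ,
                                  a~b (P i) , a~v (P i) , subst (Adj G (g j)) (sym fi≡fj) (a~b (P j)) , a~v (P j)))
  g-injective : Injective _≡_ _≡_ g
  g-injective {i} {j} gi≡gj with f i ≟ f j
  ... | yes fi≡fj = h-inj (cong₂ _,_ gi≡gj fi≡fj)
  ... | no  fi≢fj = ⊥-elim (noC4 (u , g i , f i , f j , u≢a (P i) , fi≢fj ,
                                  u~b (P i) , u~b (P j) , a~b (P i) , subst (λ a → Adj G a (f j)) (sym gi≡gj) (a~b (P j))))

pathCount-< : ∀ {m n t} {G : BipGraph m n} → ¬ ContainsC4 G → ¬ ContainsTheta3 t G → ∀ u v → pathCount G u v < t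
pathCount-< {G = G} noC4 noθ u v = Distinct-< (select₂ (path G u v)) (noθ ∘ paths⇒θ u v noC4)

edgeSum-paths : ∀ {m n} (G : BipGraph m n) →
  edgeSum G (λ a b → (degA G a ∸ 1) * (degB G b ∸ 1)) ≡ ∑[ v < n ] ∑[ u < m ] pathCount G u v
edgeSum-paths {m} {n} G = begin-equality
  ∑[ a < m ] ∑[ b < n ] (𝟙 (G a b) * ((degA G a ∸ 1) * (degB G b ∸ 1)))
    ≡⟨ sum-cong-≗ (λ a → sum-cong-≗ (λ b → paths-through a b)) ⟩
  ∑[ a < m ] ∑[ b < n ] ∑[ v < n ] ∑[ u < m ] F u v a b   ≡⟨ sum-cong-≗ (λ a → ∑-comm (λ b v → ∑[ u < m ] F u v a b)) ⟩
  ∑[ a < m ] ∑[ v < n ] ∑[ b < n ] ∑[ u < m ] F u v a b   ≡⟨ sum-cong-≗ (λ a → sum-cong-≗ (λ v → ∑-comm (λ b u → F u v a b))) ⟩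
  ∑[ a < m ] ∑[ v < n ] ∑[ u < m ] ∑[ b < n ] F u v a b   ≡⟨ ∑-comm (λ a v → ∑[ u < m ] ∑[ b < n ] F u v a b) ⟩
  ∑[ v < n ] ∑[ a < m ] ∑[ u < m ] ∑[ b < n ] F u v a b   ≡⟨ sum-cong-≗ (λ v → ∑-comm (λ a u → ∑[ b < n ] F u v a b)) ⟩
  ∑[ v < n ] ∑[ u < m ] pathCount G u v                   ∎
  where
  F = λ u v a b → 𝟙 (path G u v a b)
  paths-through : ∀ a b → 𝟙 (G a b) * ((degA G a ∸ 1) * (degB G b ∸ 1)) ≡ ∑[ v < n ] ∑[ u < m ] F u v a b
  paths-through a b = begin-equality
    𝟙 (G a b) * ((degA G a ∸ 1) * (degB G b ∸ 1))
      ≡⟨ 𝟙-*-cong (G a b) (λ ab → cong₂ _*_ (count-remove-true (G a) b ab) (count-remove-true (λ u → G u b) a ab)) ⟩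
    𝟙 (G a b) * (count P * count Q)                        ≡⟨ cong (𝟙 (G a b) *_) (count-*-count P Q) ⟩
    𝟙 (G a b) * ∑[ v < n ] ∑[ u < m ] 𝟙 (P v ∧ Q u)        ≡⟨ *-distribˡ-sum (𝟙 (G a b)) (λ v → ∑[ u < m ] 𝟙 (P v ∧ Q u)) ⟩
    ∑[ v < n ] (𝟙 (G a b) * ∑[ u < m ] 𝟙 (P v ∧ Q u))      ≡⟨ sum-cong-≗ (λ v → *-distribˡ-sum (𝟙 (G a b)) (λ u → 𝟙 (P v ∧ Q u))) ⟩
    ∑[ v < n ] ∑[ u < m ] (𝟙 (G a b) * 𝟙 (P v ∧ Q u))      ≡⟨ sum-cong-≗ (λ v → sum-cong-≗ (λ u → 𝟙-∧ (G a b) (P v ∧ Q u))) ⟩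
    ∑[ v < n ] ∑[ u < m ] F u v a b                        ∎
    where
    P = λ v → not (does (v ≟ b)) ∧ G a v
    Q = λ u → not (does (u ≟ a)) ∧ G u b

-- Edges between vertices of large degree

count-light : ∀ {k} (p : Fin k → Bool) L → count (λ i → not (L <ᵇ count p) ∧ p i) ≤ L
count-light {k} p L with L <ᵇ count p in L<ᵇd
... | true  = ≤-trans (≤-reflexive (sum-zero {k} (λ _ → refl))) z≤n
... | false = <ᵇ-false⇒≥ L<ᵇd

𝟙-split₃ : ∀ x y z → 𝟙 z ≤ 𝟙 ((x ∧ y) ∧ z) + 𝟙 (not x ∧ z) + 𝟙 (not y ∧ z)
𝟙-split₃ true  true  z = ≤-trans (m≤m+n (𝟙 z) 0) (m≤m+n (𝟙 z + 0) 0)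
𝟙-split₃ true  false z = m≤n+m (𝟙 z) 0
𝟙-split₃ false y     z = m≤m+n (𝟙 z) (𝟙 (not y ∧ z))

heavyPart : ∀ {m n} → BipGraph m n → ℕ → BipGraph m n
heavyPart G L a b = ((L <ᵇ degA G a) ∧ (L <ᵇ degB G b)) ∧ G a b

heavyPart-⊆ : ∀ {m n} (G : BipGraph m n) L → heavyPart G L ⊆ G
heavyPart-⊆ G L a b = ∧-conicalʳ _ (G a b)

heavyPart-heavy : ∀ {m n} (G : BipGraph m n) L → ∀ a b → heavyPart G L a b ≡ true → L < degA G a × L < degB G b
heavyPart-heavy G L a b ab = <ᵇ-true⇒< (∧-conicalˡ _ _ both) , <ᵇ-true⇒< (∧-conicalʳ (L <ᵇ degA G a) _ both)
  where both = ∧-conicalˡ _ (G a b) ab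

edges-≤-heavyPart : ∀ {m n} (G : BipGraph m n) L → edges m n G ≤ edges m n (heavyPart G L) + m * L + n * L
edges-≤-heavyPart {m} {n} G L = begin
  edges m n G                                  ≡⟨ edges≡∑degA G ⟩
  ∑[ a < m ] ∑[ b < n ] 𝟙 (G a b)              ≤⟨ sum-mono-≤ (λ a → sum-mono-≤ (λ b → 𝟙-split₃ (hA a) (hB b) (G a b))) ⟩
  ∑[ a < m ] ∑[ b < n ] (𝟙 (heavyPart G L a b) + 𝟙 (not (hA a) ∧ G a b) + 𝟙 (not (hB b) ∧ G a b))
    ≡⟨ sum-cong-≗ (λ a → ∑-distrib-+₃ (λ b → 𝟙 (heavyPart G L a b)) (λ b → 𝟙 (not (hA a) ∧ G a b)) (λ b → 𝟙 (not (hB b) ∧ G a b))) ⟩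
  ∑[ a < m ] (degA (heavyPart G L) a + lightA a + lightB′ a)  ≡⟨ ∑-distrib-+₃ (degA (heavyPart G L)) lightA lightB′ ⟩
  sum (degA (heavyPart G L)) + sum lightA + ∑[ a < m ] ∑[ b < n ] 𝟙 (not (hB b) ∧ G a b)
    ≡⟨ cong₂ _+_ (cong (_+ sum lightA) (sym (edges≡∑degA (heavyPart G L)))) (∑-comm (λ a b → 𝟙 (not (hB b) ∧ G a b))) ⟩
  edges m n (heavyPart G L) + sum lightA + sum lightB
    ≤⟨ +-mono-≤ (+-monoʳ-≤ (edges m n (heavyPart G L)) (sum≤k*c (λ a → count-light (G a) L))) (sum≤k*c (λ b → count-light (λ a → G a b) L)) ⟩
  edges m n (heavyPart G L) + m * L + n * L    ∎
  where
  hA = λ a → L <ᵇ degA G a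
  hB = λ b → L <ᵇ degB G b
  lightA = λ a → count (λ b → not (hA a) ∧ G a b)
  lightB = λ b → count (λ a → not (hB b) ∧ G a b)
  lightB′ = λ a → ∑[ b < n ] 𝟙 (not (hB b) ∧ G a b)

*-suc-/₀-≤ : ∀ {δ x L} Q → 1 ≤ L → L ≤ x → δ ≤ suc x → δ * suc ((L * Q) /₀ x) ≤ δ + (Q + L * Q)
*-suc-/₀-≤ {δ} {x} {L} Q 1≤L L≤x δ≤1+x = begin
  δ * suc q        ≡⟨ *-suc δ q ⟩
  δ + δ * q        ≤⟨ +-monoʳ-≤ δ (*-monoˡ-≤ q δ≤1+x) ⟩
  δ + (q + x * q)  ≤⟨ +-monoʳ-≤ δ (+-mono-≤ q≤Q (*-/₀-≤ (L * Q) x)) ⟩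
  δ + (Q + L * Q)  ∎
  where
  q = (L * Q) /₀ x
  q≤Q : q ≤ Q
  q≤Q = *-cancelˡ-≤ L {{>-nonZero 1≤L}} (≤-trans (*-monoˡ-≤ q L≤x) (*-/₀-≤ (L * Q) x))

heavy-weight-sum : ∀ {m n} {G H : BipGraph m n} {L} Q → 1 ≤ L → H ⊆ G → (∀ a b → H a b ≡ true → L < degA G a) →
  edgeSum H (λ a _ → suc ((L * Q) /₀ (degA G a ∸ 1))) ≤ edges m n H + m * (Q + L * Q)
heavy-weight-sum {m} {n} {G} {H} {L} Q 1≤L H⊆G H-heavy = begin
  edgeSum H (λ a _ → w a)                ≡⟨ edgeSum-vertex H w ⟩
  ∑[ a < m ] (degA H a * w a)            ≤⟨ sum-mono-≤ vertex-bound ⟩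
  ∑[ a < m ] (degA H a + (Q + L * Q))    ≡⟨ ∑-distrib-+ (degA H) (λ _ → Q + L * Q) ⟩
  sum (degA H) + ∑[ a < m ] (Q + L * Q)  ≡⟨ cong₂ _+_ (sym (edges≡∑degA H)) (sum-const m (Q + L * Q)) ⟩
  edges m n H + m * (Q + L * Q)          ∎
  where
  w = λ a → suc ((L * Q) /₀ (degA G a ∸ 1))
  vertex-bound : ∀ a → degA H a * w a ≤ degA H a + (Q + L * Q)
  vertex-bound a with L <? degA G a
  ... | yes L<d = *-suc-/₀-≤ Q 1≤L (<⇒≤pred L<d)
                    (≤-trans (sum-mono-≤ (λ b → 𝟙-mono-≤ (H⊆G a b))) (m≤n+m∸n (degA G a) 1))
  ... | no  L≮d = subst (λ δ → δ * w a ≤ δ + (Q + L * Q)) (sym (sum-zero no-edge)) z≤n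
    where
    no-edge : ∀ b → 𝟙 (H a b) ≡ 0
    no-edge b with H a b in ab
    ... | true  = ⊥-elim (L≮d (H-heavy a b ab))
    ... | false = refl

amgm-edge : ∀ {R T m n P x y cx cy} → T * (m * m) * (n * n) ≤ R * R * R → P ≤ x * cx → P ≤ y * cy →
  3 * (T * m * n * P) ≤ R * P * (x * y) + R * T * n * cx + R * T * m * cy
amgm-edge {R} {T} {m} {n} {P} {x} {y} {cx} {cy} X≤R³ P≤x*cx P≤y*cy = amgm₃-root (R * P * (x * y)) (R * T * n * cx) (R * T * m * cy) {T * m * n * P} (begin
  T * m * n * P * (T * m * n * P) * (T * m * n * P)          ≡⟨ solve (T ∷ m ∷ n ∷ P ∷ []) ⟩
  T * (m * m) * (n * n) * (T * T * m * n * (P * (P * P)))     ≤⟨ *-monoˡ-≤ (T * T * m * n * (P * (P * P))) X≤R³ ⟩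
  R * R * R * (T * T * m * n * (P * (P * P)))                 ≤⟨ *-monoʳ-≤ (R * R * R) (*-monoʳ-≤ (T * T * m * n)
                                                                   (*-monoʳ-≤ P (*-mono-≤ P≤x*cx P≤y*cy))) ⟩
  R * R * R * (T * T * m * n * (P * ((x * cx) * (y * cy))))   ≡⟨ solve (R ∷ T ∷ m ∷ n ∷ P ∷ x ∷ y ∷ cx ∷ cy ∷ []) ⟩
  R * P * (x * y) * (R * T * n * cx) * (R * T * m * cy)       ∎)

heavy-amgm : ∀ {m n} {G H : BipGraph m n} {L R T} → 1 ≤ L → T * (m * m) * (n * n) ≤ R * R * R →
  (∀ a b → H a b ≡ true → L < degA G a × L < degB G b) →
  edges m n H * (3 * (T * m * n * (L * (2 * n))))
    ≤ R * (L * (2 * n)) * edgeSum H (λ a b → (degA G a ∸ 1) * (degB G b ∸ 1))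
      + R * T * n * edgeSum H (λ a _ → suc ((L * (2 * n)) /₀ (degA G a ∸ 1)))
      + R * T * m * edgeSum H (λ _ b → suc ((L * (2 * n)) /₀ (degB G b ∸ 1)))
heavy-amgm {m} {n} {G} {H} {L} {R} {T} 1≤L X≤R³ H-heavy = begin
  edges m n H * (3 * D)                                      ≡⟨ edgeSum-const H (3 * D) ⟨
  edgeSum H (λ _ _ → 3 * D)                                  ≤⟨ edgeSum-mono-≤ H amgm-at ⟩
  edgeSum H (λ a b → p a b + q a + s b)                      ≡⟨ edgeSum-+ H (λ a b → p a b + q a) (λ _ b → s b) ⟩
  edgeSum H (λ a b → p a b + q a) + edgeSum H (λ _ b → s b)  ≡⟨ cong (_+ edgeSum H (λ _ b → s b)) (edgeSum-+ H p (λ a _ → q a)) ⟩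
  edgeSum H p + edgeSum H (λ a _ → q a) + edgeSum H (λ _ b → s b)
    ≡⟨ cong₂ _+_ (cong₂ _+_ (edgeSum-*ˡ H (R * P) (λ a b → x a * y b)) (edgeSum-*ˡ H (R * T * n) (λ a _ → cA a)))
                 (edgeSum-*ˡ H (R * T * m) (λ _ b → cB b)) ⟩
  R * P * edgeSum H (λ a b → x a * y b) + R * T * n * edgeSum H (λ a _ → cA a) + R * T * m * edgeSum H (λ _ b → cB b) ∎
  where
  P = L * (2 * n)
  D = T * m * n * P
  x = λ a → degA G a ∸ 1
  y = λ b → degB G b ∸ 1
  cA = λ a → suc (P /₀ x a)
  cB = λ b → suc (P /₀ y b)
  p = λ a b → R * P * (x a * y b)
  q = λ a → R * T * n * cA a
  s = λ b → R * T * m * cB b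
  P≤*c : ∀ {d} → L < d → P ≤ (d ∸ 1) * suc (P /₀ (d ∸ 1))
  P≤*c L<d = ≤-*-suc-/₀ P (≤-trans 1≤L (<⇒≤pred L<d))
  amgm-at : ∀ a b → H a b ≡ true → 3 * D ≤ p a b + q a + s b
  amgm-at a b ab = amgm-edge {R} {T} {m} {n} {P} {x a} {y b} {cA a} {cB b} X≤R³
                     (P≤*c (proj₁ (H-heavy a b ab))) (P≤*c (proj₂ (H-heavy a b ab)))

amgm-sum-cancel : ∀ {T m n L R e S A B} → 1 ≤ T → 1 ≤ m → 1 ≤ n →
  e * (3 * (T * m * n * (L * (2 * n)))) ≤ R * (L * (2 * n)) * S + R * T * n * A + R * T * m * B →
  S ≤ n * (m * T) → A ≤ m * n + m * (2 * n + L * (2 * n)) → B ≤ n * n + n * (2 * n + L * (2 * n)) →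
  L * e ≤ L * R + R
amgm-sum-cancel {T} {m} {n} {L} {R} {e} {S} {A} {B} 1≤T 1≤m 1≤n amgm S≤ A≤ B≤ =
  *-cancelˡ-≤ (T * m * n * (6 * n)) {{>-nonZero (*-mono-≤ (*-mono-≤ (*-mono-≤ 1≤T 1≤m) 1≤n) (*-mono-≤ (s≤s (z≤n {5})) 1≤n))}} (begin
  T * m * n * (6 * n) * (L * e)                            ≡⟨ solve (T ∷ m ∷ n ∷ L ∷ e ∷ []) ⟩
  e * (3 * (T * m * n * (L * (2 * n))))                    ≤⟨ amgm ⟩
  R * (L * (2 * n)) * S + R * T * n * A + R * T * m * B
    ≤⟨ +-mono-≤ (+-mono-≤ (*-monoʳ-≤ (R * (L * (2 * n))) S≤) (*-monoʳ-≤ (R * T * n) A≤)) (*-monoʳ-≤ (R * T * m) B≤) ⟩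
  R * (L * (2 * n)) * (n * (m * T)) + R * T * n * (m * n + m * (2 * n + L * (2 * n)))
    + R * T * m * (n * n + n * (2 * n + L * (2 * n)))      ≡⟨ solve (T ∷ m ∷ n ∷ L ∷ R ∷ []) ⟩
  T * m * n * (6 * n) * (L * R + R)                        ∎)

heavy-edges-bound : ∀ {m n} {G H : BipGraph m n} {L R T} → 1 ≤ L → 1 ≤ T → 1 ≤ m → m ≤ n →
  T * (m * m) * (n * n) ≤ R * R * R → (∀ u v → pathCount G u v ≤ T) →
  H ⊆ G → (∀ a b → H a b ≡ true → L < degA G a × L < degB G b) →
  L * edges m n H ≤ L * R + R
heavy-edges-bound {m} {n} {G} {H} {L} {R} {T} 1≤L 1≤T 1≤m m≤n X≤R³ paths≤T H⊆G H-heavy =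
  amgm-sum-cancel {T} {m} {n} {L} {R} {edges m n H} 1≤T 1≤m (≤-trans 1≤m m≤n) (heavy-amgm {G = G} {H} {L} {R} {T} 1≤L X≤R³ H-heavy)
    paths-bound A-bound B-bound
  where
  Q = 2 * n
  P = L * Q
  paths-bound : edgeSum H (λ a b → (degA G a ∸ 1) * (degB G b ∸ 1)) ≤ n * (m * T)
  paths-bound = begin
    edgeSum H (λ a b → (degA G a ∸ 1) * (degB G b ∸ 1)) ≤⟨ edgeSum-⊆ (λ a b → (degA G a ∸ 1) * (degB G b ∸ 1)) H⊆G ⟩
    edgeSum G (λ a b → (degA G a ∸ 1) * (degB G b ∸ 1)) ≡⟨ edgeSum-paths G ⟩
    ∑[ v < n ] ∑[ u < m ] pathCount G u v                ≤⟨ sum≤k*c (λ v → sum≤k*c (λ u → paths≤T u v)) ⟩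
    n * (m * T)                                          ∎
  A-bound : edgeSum H (λ a _ → suc (P /₀ (degA G a ∸ 1))) ≤ m * n + m * (Q + P)
  A-bound = begin
    edgeSum H (λ a _ → suc (P /₀ (degA G a ∸ 1))) ≤⟨ heavy-weight-sum Q 1≤L H⊆G (λ a b → proj₁ ∘ H-heavy a b) ⟩
    edges m n H + m * (Q + P)                     ≤⟨ +-monoˡ-≤ (m * (Q + P)) (edges≤m*n H) ⟩
    m * n + m * (Q + P)                           ∎
  B-bound : edgeSum H (λ _ b → suc (P /₀ (degB G b ∸ 1))) ≤ n * n + n * (Q + P)
  B-bound = begin
    edgeSum H (λ _ b → suc (P /₀ (degB G b ∸ 1)))             ≡⟨ edgeSum-transpose H (λ _ b → suc (P /₀ (degB G b ∸ 1))) ⟨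
    edgeSum (transpose H) (λ b _ → suc (P /₀ (degB G b ∸ 1))) ≤⟨ heavy-weight-sum Q 1≤L (λ b a → H⊆G a b) (λ b a → proj₂ ∘ H-heavy a b) ⟩
    edges n m (transpose H) + n * (Q + P)                     ≡⟨ cong (_+ n * (Q + P)) (edges-transpose H) ⟩
    edges m n H + n * (Q + P)                                 ≤⟨ +-monoˡ-≤ (n * (Q + P)) (≤-trans (edges≤m*n H) (*-monoˡ-≤ n m≤n)) ⟩
    n * n + n * (Q + P)                                       ∎

-- Arithmetic of the parameters

<-cancel-scaled-fourth : ∀ {k z σ} →
  suc (suc k) * suc (suc k) * suc (suc k) * suc (suc k) * z < σ * suc k * (σ * suc k) * (σ * suc k) * (σ * suc k) →
  z < σ * σ * (σ * σ)
<-cancel-scaled-fourth {k} {z} {σ} bracket = *-cancelˡ-< (suc k * suc k * (suc k * suc k)) z (σ * σ * (σ * σ)) (begin-strict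
  suc k * suc k * (suc k * suc k) * z                          ≤⟨ *-monoˡ-≤ z (fourth-mono-≤ (n≤1+n (suc k))) ⟩
  suc (suc k) * suc (suc k) * (suc (suc k) * suc (suc k)) * z  ≡⟨ solve (k ∷ z ∷ []) ⟩
  suc (suc k) * suc (suc k) * suc (suc k) * suc (suc k) * z    <⟨ bracket ⟩
  σ * suc k * (σ * suc k) * (σ * suc k) * (σ * suc k)          ≡⟨ solve (σ ∷ k ∷ []) ⟩
  suc k * suc k * (suc k * suc k) * (σ * σ * (σ * σ))          ∎)

Y-as-product : ∀ t n m → t ^ 4 * n ^ 3 * m ^ 2 ≡ t * t * t * t * (n * n * n) * (m * m)
Y-as-product t n m = unfolded
  where
  unfolded : t * (t * (t * (t * 1))) * (n * (n * (n * 1))) * (m * (m * 1)) ≡ t * t * t * t * (n * n * n) * (m * m)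
  unfolded = solve (t ∷ n ∷ m ∷ [])

n≤n*n*n : ∀ x → x ≤ x * x * x
n≤n*n*n zero        = z≤n
n≤n*n*n x@(suc _)   = m≤n*m x (x * x)

n≤[n*K]⁴ : ∀ k x → x ≤ x * suc k * (x * suc k) * (x * suc k) * (x * suc k)
n≤[n*K]⁴ k zero      = z≤n
n≤[n*K]⁴ k x@(suc _) = ≤-trans (m≤m*n x (suc k)) (m≤n*m (x * suc k) (x * suc k * (x * suc k) * (x * suc k)))

edges-≤-quadratic : ∀ {e n M r} → e * e ≤ n * e + M → M < suc r * suc r → e ≤ n + r
edges-≤-quadratic {e} {n} {M} {r} e²≤ M<σ² with e ≤? n + r
... | yes e≤n+r = e≤n+r
... | no  e≰n+r = ⊥-elim (<⇒≱ ne+M<e² e²≤)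
  where
  n+σ≤e : n + suc r ≤ e
  n+σ≤e = subst (_≤ e) (sym (+-suc n r)) (≰⇒> e≰n+r)
  ne+M<e² : n * e + M < e * e
  ne+M<e² = begin-strict
    n * e + M                 <⟨ +-monoʳ-< (n * e) M<σ² ⟩
    n * e + suc r * suc r     ≤⟨ +-monoʳ-≤ (n * e) (*-monoˡ-≤ (suc r) (≤-trans (m≤n+m (suc r) n) n+σ≤e)) ⟩
    n * e + e * suc r         ≡⟨ solve (n ∷ e ∷ r ∷ []) ⟩
    e * (n + suc r)           ≤⟨ *-monoʳ-≤ e n+σ≤e ⟩
    e * e                     ∎

sparse-nm²<σ² : ∀ {t n m σ} → m * m ≤ t * t * t * t * n →
  t * t * t * t * (n * n * n) * (m * m) < σ * σ * (σ * σ) → n * (m * m) < σ * σ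
sparse-nm²<σ² {t} {n} {m} {σ} m²≤t⁴n Y<σ⁴ = mono-cancel-< (λ x → x * x) square-mono-≤ (begin-strict
  n * (m * m) * (n * (m * m))               ≡⟨ solve (n ∷ m ∷ []) ⟩
  n * n * (m * m) * (m * m)                 ≤⟨ *-monoʳ-≤ (n * n * (m * m)) m²≤t⁴n ⟩
  n * n * (m * m) * (t * t * t * t * n)     ≡⟨ solve (t ∷ n ∷ m ∷ []) ⟩
  t * t * t * t * (n * n * n) * (m * m)     <⟨ Y<σ⁴ ⟩
  σ * σ * (σ * σ)                           ∎)

16≤t⁴ : ∀ {t} → 2 ≤ t → 16 ≤ t * t * t * t
16≤t⁴ 2≤t = *-mono-≤ (*-mono-≤ (*-mono-≤ 2≤t 2≤t) 2≤t) 2≤t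

dense-4n<σ : ∀ {t n m σ} → 2 ≤ t → t * t * t * t * n < m * m →
  t * t * t * t * (n * n * n) * (m * m) < σ * σ * (σ * σ) → 4 * n < σ
dense-4n<σ {t} {n} {m} {σ} 2≤t t⁴n<m² Y<σ⁴ = mono-cancel-< (λ x → x * x * (x * x)) fourth-mono-≤ (begin-strict
  4 * n * (4 * n) * (4 * n * (4 * n))                 ≡⟨ solve (n ∷ []) ⟩
  16 * 16 * (n * n * n * n)                           ≤⟨ *-monoˡ-≤ (n * n * n * n) (*-mono-≤ (16≤t⁴ 2≤t) (16≤t⁴ 2≤t)) ⟩
  t * t * t * t * (t * t * t * t) * (n * n * n * n)   ≡⟨ solve (t ∷ n ∷ []) ⟩
  t * t * t * t * (n * n * n) * (t * t * t * t * n)   ≤⟨ *-monoʳ-≤ (t * t * t * t * (n * n * n)) (<⇒≤ t⁴n<m²) ⟩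
  t * t * t * t * (n * n * n) * (m * m)               <⟨ Y<σ⁴ ⟩
  σ * σ * (σ * σ)                                     ∎)

dense-5nρ≤σ² : ∀ {t n m T ρ σ} → 2 ≤ t → T ≤ t → t * t * t * t * n < m * m →
  ρ * ρ * ρ ≤ T * (m * m) * (n * n) → t * t * t * t * (n * n * n) * (m * m) < σ * σ * (σ * σ) →
  5 * n * ρ ≤ σ * σ
dense-5nρ≤σ² {t} {n} {m} {T} {ρ} {σ} 2≤t T≤t t⁴n<m² ρ³≤X Y<σ⁴ =
  <⇒≤ (mono-cancel-< (λ x → x * x * x * (x * x * x)) (λ le → *-mono-≤ (cube-mono-≤ le) (cube-mono-≤ le)) (begin-strict
  5 * n * ρ * (5 * n * ρ) * (5 * n * ρ) * (5 * n * ρ * (5 * n * ρ) * (5 * n * ρ))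
    ≡⟨ solve (n ∷ ρ ∷ []) ⟩
  15625 * (n * n * n * (n * n * n)) * (ρ * ρ * ρ * (ρ * ρ * ρ))
    ≤⟨ *-monoʳ-≤ (15625 * (n * n * n * (n * n * n))) (*-mono-≤ ρ³≤X ρ³≤X) ⟩
  15625 * (n * n * n * (n * n * n)) * (T * (m * m) * (n * n) * (T * (m * m) * (n * n)))
    ≡⟨ solve (T ∷ n ∷ m ∷ []) ⟩
  15625 * (T * T) * (m * m * (m * m) * (n * n * n * n * (n * n * n) * (n * n * n)))
    ≤⟨ *-monoˡ-≤ _ (*-mono-≤ (m≤m+n 15625 759) (*-mono-≤ T≤t T≤t)) ⟩
  16 * 16 * 16 * 4 * (t * t) * (m * m * (m * m) * (n * n * n * n * (n * n * n) * (n * n * n)))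
    ≤⟨ *-monoˡ-≤ _ (*-monoˡ-≤ (t * t) (*-mono-≤ (*-mono-≤ (*-mono-≤ (16≤t⁴ 2≤t) (16≤t⁴ 2≤t)) (16≤t⁴ 2≤t)) (*-mono-≤ 2≤t 2≤t))) ⟩
  t * t * t * t * (t * t * t * t) * (t * t * t * t) * (t * t) * (t * t) * (m * m * (m * m) * (n * n * n * n * (n * n * n) * (n * n * n)))
    ≡⟨ solve (t ∷ n ∷ m ∷ []) ⟩
  t * t * t * t * (n * n * n) * (m * m) * (t * t * t * t * (n * n * n) * (m * m)) * (t * t * t * t * (n * n * n)) * (t * t * t * t * n)
    ≤⟨ *-monoʳ-≤ (t * t * t * t * (n * n * n) * (m * m) * (t * t * t * t * (n * n * n) * (m * m)) * (t * t * t * t * (n * n * n))) (<⇒≤ t⁴n<m²) ⟩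
  t * t * t * t * (n * n * n) * (m * m) * (t * t * t * t * (n * n * n) * (m * m)) * (t * t * t * t * (n * n * n)) * (m * m)
    ≡⟨ solve (t ∷ n ∷ m ∷ []) ⟩
  t * t * t * t * (n * n * n) * (m * m) * (t * t * t * t * (n * n * n) * (m * m)) * (t * t * t * t * (n * n * n) * (m * m))
    <⟨ cube-mono-< Y<σ⁴ ⟩
  σ * σ * (σ * σ) * (σ * σ * (σ * σ)) * (σ * σ * (σ * σ))
    ≡⟨ solve (σ ∷ []) ⟩
  σ * σ * (σ * σ) * (σ * σ) * (σ * σ * (σ * σ) * (σ * σ)) ∎))

cρ³≤nσ³ : ∀ {t n m T ρ σ c} → 1 ≤ t → T ≤ t → c * c * c * c ≤ n * n * n → m ≤ n →
  ρ * ρ * ρ ≤ T * (m * m) * (n * n) → t * t * t * t * (n * n * n) * (m * m) < σ * σ * (σ * σ) →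
  c * (ρ * ρ * ρ) ≤ n * (σ * σ * σ)
cρ³≤nσ³ {t} {n} {m} {T} {ρ} {σ} {c} 1≤t T≤t c⁴≤n³ m≤n ρ³≤X Y<σ⁴ = strictMono-cancel-≤ (λ x → x * x * (x * x)) fourth-mono-< (begin
  c * (ρ * ρ * ρ) * (c * (ρ * ρ * ρ)) * (c * (ρ * ρ * ρ) * (c * (ρ * ρ * ρ)))
    ≡⟨ solve (c ∷ ρ ∷ []) ⟩
  c * c * c * c * (ρ * ρ * ρ * (ρ * ρ * ρ) * (ρ * ρ * ρ * (ρ * ρ * ρ)))
    ≤⟨ *-monoʳ-≤ (c * c * c * c) (fourth-mono-≤ ρ³≤X) ⟩
  c * c * c * c * (T * (m * m) * (n * n) * (T * (m * m) * (n * n)) * (T * (m * m) * (n * n) * (T * (m * m) * (n * n))))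
    ≡⟨ solve (c ∷ T ∷ m ∷ n ∷ []) ⟩
  c * c * c * c * (T * T * T * T) * (m * m * m * m * m * m * (m * m)) * (n * n * n * n * (n * n * n * n))
    ≤⟨ *-monoˡ-≤ (n * n * n * n * (n * n * n * n)) (*-mono-≤ (*-mono-≤ c⁴≤n³ T⁴≤t¹²) (*-monoʳ-≤ (m * m * m * m * m * m) (square-mono-≤ m≤n))) ⟩
  n * n * n * (t * t * t * t * (t * t * t * t) * (t * t * t * t)) * (m * m * m * m * m * m * (n * n)) * (n * n * n * n * (n * n * n * n))
    ≡⟨ solve (t ∷ m ∷ n ∷ []) ⟩
  n * n * (n * n) * (t * t * t * t * (n * n * n) * (m * m) * (t * t * t * t * (n * n * n) * (m * m)) * (t * t * t * t * (n * n * n) * (m * m)))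
    ≤⟨ *-monoʳ-≤ (n * n * (n * n)) (<⇒≤ (cube-mono-< Y<σ⁴)) ⟩
  n * n * (n * n) * (σ * σ * (σ * σ) * (σ * σ * (σ * σ)) * (σ * σ * (σ * σ)))
    ≡⟨ solve (n ∷ σ ∷ []) ⟩
  n * (σ * σ * σ) * (n * (σ * σ * σ)) * (n * (σ * σ * σ) * (n * (σ * σ * σ))) ∎)
  where
  t⁴≥1 : 1 ≤ t * t * t * t
  t⁴≥1 = *-mono-≤ (cube-mono-≤ 1≤t) 1≤t
  T⁴≤t¹² : T * T * T * T ≤ t * t * t * t * (t * t * t * t) * (t * t * t * t)
  T⁴≤t¹² = begin
    T * T * T * T                                         ≤⟨ *-mono-≤ (cube-mono-≤ T≤t) T≤t ⟩
    t * t * t * t                                         ≤⟨ m≤m*n (t * t * t * t) (t * t * t * t) {{>-nonZero t⁴≥1}} ⟩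
    t * t * t * t * (t * t * t * t)                       ≤⟨ m≤m*n _ (t * t * t * t) {{>-nonZero t⁴≥1}} ⟩
    t * t * t * t * (t * t * t * t) * (t * t * t * t)     ∎

dense-512ρ³≤nr³ : ∀ {t n m T ρ r} → 1 ≤ t → T ≤ t → 65536 ≤ n → m ≤ n → 1 ≤ r →
  ρ * ρ * ρ ≤ T * (m * m) * (n * n) → t * t * t * t * (n * n * n) * (m * m) < suc r * suc r * (suc r * suc r) →
  512 * (ρ * ρ * ρ) ≤ n * (r * r * r)
dense-512ρ³≤nr³ {t} {n} {m} {T} {ρ} {r} 1≤t T≤t 65536≤n m≤n 1≤r ρ³≤X Y<σ⁴ = *-cancelˡ-≤ 8 (begin
  8 * (512 * (ρ * ρ * ρ))                 ≡⟨ *-assoc 8 512 (ρ * ρ * ρ) ⟨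
  4096 * (ρ * ρ * ρ)                      ≤⟨ cρ³≤nσ³ {t} {n} {m} {T} {ρ} {suc r} {4096} 1≤t T≤t (cube-mono-≤ 65536≤n) m≤n ρ³≤X Y<σ⁴ ⟩
  n * (suc r * suc r * suc r)             ≤⟨ *-monoʳ-≤ n (cube-mono-≤ (+-monoˡ-≤ r 1≤r)) ⟩
  n * ((r + r) * (r + r) * (r + r))       ≡⟨ solve (n ∷ r ∷ []) ⟩
  8 * (n * (r * r * r))                   ∎)

dense-4nR+2r≤r² : ∀ {n ρ r} → 6 ≤ n → 4 * n < suc r → 5 * n * ρ ≤ suc r * suc r → 4 * n * suc ρ + 2 * r ≤ r * r
dense-4nR+2r≤r² {n} {ρ} {r} 6≤n 4n<σ 5nρ≤σ² = *-cancelˡ-≤ 5 (begin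
  5 * (4 * n * suc ρ + 2 * r)              ≡⟨ solve (n ∷ ρ ∷ r ∷ []) ⟩
  4 * (5 * n * ρ) + 5 * (4 * n) + 10 * r   ≤⟨ +-monoˡ-≤ (10 * r) (+-mono-≤ (*-monoʳ-≤ 4 5nρ≤σ²) (*-monoʳ-≤ 5 4n≤r)) ⟩
  4 * (suc r * suc r) + 5 * r + 10 * r     ≡⟨ solve (r ∷ []) ⟩
  4 * (r * r) + (23 * r + 4)               ≤⟨ +-monoʳ-≤ (4 * (r * r)) 23r+4≤r² ⟩
  4 * (r * r) + r * r                      ≡⟨ solve (r ∷ []) ⟩
  5 * (r * r)                              ∎)
  where
  4n≤r : 4 * n ≤ r
  4n≤r = s≤s⁻¹ 4n<σ
  24≤r : 24 ≤ r
  24≤r = ≤-trans (*-monoʳ-≤ 4 6≤n) 4n≤r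
  23r+4≤r² : 23 * r + 4 ≤ r * r
  23r+4≤r² = begin
    23 * r + 4 ≤⟨ +-monoʳ-≤ (23 * r) (≤-trans (m≤m+n 4 20) 24≤r) ⟩
    23 * r + r ≡⟨ solve (r ∷ []) ⟩
    24 * r     ≤⟨ *-monoˡ-≤ r 24≤r ⟩
    r * r      ∎

dense-[2R+r]³≤nr³ : ∀ {n ρ r} → 8 ≤ n → 1 ≤ ρ → 512 * (ρ * ρ * ρ) ≤ n * (r * r * r) →
  (2 * suc ρ + r) * (2 * suc ρ + r) * (2 * suc ρ + r) ≤ n * (r * r * r)
dense-[2R+r]³≤nr³ {n} {ρ} {r} 8≤n 1≤ρ 512ρ³≤nr³ with 2 * suc ρ ≤? r
... | yes 2R≤r = begin
  (2 * suc ρ + r) * (2 * suc ρ + r) * (2 * suc ρ + r) ≤⟨ cube-mono-≤ (+-monoˡ-≤ r 2R≤r) ⟩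
  (r + r) * (r + r) * (r + r)                         ≡⟨ solve (r ∷ []) ⟩
  8 * (r * r * r)                                     ≤⟨ *-monoˡ-≤ (r * r * r) 8≤n ⟩
  n * (r * r * r)                                     ∎
... | no  2R≰r = begin
  (2 * suc ρ + r) * (2 * suc ρ + r) * (2 * suc ρ + r) ≤⟨ cube-mono-≤ 2R+r≤8ρ ⟩
  8 * ρ * (8 * ρ) * (8 * ρ)                           ≡⟨ solve (ρ ∷ []) ⟩
  512 * (ρ * ρ * ρ)                                   ≤⟨ 512ρ³≤nr³ ⟩
  n * (r * r * r)                                     ∎
  where
  2R+r≤8ρ : 2 * suc ρ + r ≤ 8 * ρ
  2R+r≤8ρ = begin
    2 * suc ρ + r           ≤⟨ +-monoʳ-≤ (2 * suc ρ) (<⇒≤ (≰⇒> 2R≰r)) ⟩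
    2 * suc ρ + 2 * suc ρ   ≡⟨ solve (ρ ∷ []) ⟩
    4 + 4 * ρ               ≤⟨ +-monoˡ-≤ (4 * ρ) (*-monoʳ-≤ 4 1≤ρ) ⟩
    4 * ρ + 4 * ρ           ≡⟨ solve (ρ ∷ []) ⟩
    8 * ρ                   ∎

cube-≤-of-scaled : ∀ {L r n c} → 1 ≤ r → L * r ≤ c → c * c * c ≤ n * (r * r * r) → L * L * L ≤ n
cube-≤-of-scaled {L} {r} {n} {c} 1≤r Lr≤c c³≤nr³ = *-cancelʳ-≤ (L * L * L) n (r * r * r) {{>-nonZero (cube-mono-≤ 1≤r)}} (begin
  L * L * L * (r * r * r)       ≡⟨ solve (L ∷ r ∷ []) ⟩
  L * r * (L * r) * (L * r)     ≤⟨ cube-mono-≤ Lr≤c ⟩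
  c * c * c                     ≤⟨ c³≤nr³ ⟩
  n * (r * r * r)               ∎)

dense-edges-≤ : ∀ {e e₂ m n w ρ r} → e ≤ e₂ + m * suc w + n * suc w → suc w * e₂ ≤ suc w * suc ρ + suc ρ →
  2 * suc ρ < suc w * r → w * r ≤ 2 * suc ρ → 4 * n * suc ρ + 2 * r ≤ r * r → e ≤ ρ + r + m * suc w + n
dense-edges-≤ {e} {e₂} {m} {n} {w} {ρ} {r} e≤ Le₂≤ 2R<Lr wr≤2R 4nR+2r≤r² = *-cancelˡ-≤ (suc w) (*-cancelˡ-≤ 2 (begin
  2 * (suc w * e)                                                       ≤⟨ *-monoʳ-≤ 2 (*-monoʳ-≤ (suc w) e≤) ⟩
  2 * (suc w * (e₂ + m * suc w + n * suc w))                            ≡⟨ solve (w ∷ e₂ ∷ m ∷ n ∷ []) ⟩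
  2 * (suc w * e₂) + 2 * (suc w * (m * suc w + n * suc w))              ≤⟨ +-monoˡ-≤ (2 * (suc w * (m * suc w + n * suc w))) (*-monoʳ-≤ 2 Le₂≤) ⟩
  2 * (suc w * suc ρ + suc ρ) + 2 * (suc w * (m * suc w + n * suc w))   ≡⟨ solve (w ∷ ρ ∷ m ∷ n ∷ []) ⟩
  2 * (suc w * ρ) + 2 * (suc w * (m * suc w)) + 2 * (suc w * n) + 2 * suc ρ + suc w * (2 + 2 * n * w)
    ≤⟨ +-mono-≤ (+-monoʳ-≤ (2 * (suc w * ρ) + 2 * (suc w * (m * suc w)) + 2 * (suc w * n)) (<⇒≤ 2R<Lr)) (*-monoʳ-≤ (suc w) 2+2nw≤r) ⟩
  2 * (suc w * ρ) + 2 * (suc w * (m * suc w)) + 2 * (suc w * n) + suc w * r + suc w * r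
                                                                        ≡⟨ solve (w ∷ ρ ∷ m ∷ n ∷ r ∷ []) ⟩
  2 * (suc w * (ρ + r + m * suc w + n))                                 ∎))
  where
  1≤r : 1 ≤ r
  1≤r = *-cancelˡ-< (suc w) 0 r (subst (_< suc w * r) (sym (*-zeroʳ (suc w))) (≤-<-trans z≤n 2R<Lr))
  2+2nw≤r : 2 + 2 * n * w ≤ r
  2+2nw≤r = *-cancelʳ-≤ (2 + 2 * n * w) r r {{>-nonZero 1≤r}} (begin
    (2 + 2 * n * w) * r        ≡⟨ solve (n ∷ w ∷ r ∷ []) ⟩
    2 * r + 2 * n * (w * r)    ≤⟨ +-monoʳ-≤ (2 * r) (*-monoʳ-≤ (2 * n) wr≤2R) ⟩
    2 * r + 2 * n * (2 * suc ρ) ≡⟨ solve (n ∷ ρ ∷ r ∷ []) ⟩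
    4 * n * suc ρ + 2 * r      ≤⟨ 4nR+2r≤r² ⟩
    r * r                      ∎)

cube-≤-m³n : ∀ {m L n} → L * L * L ≤ n → m * L * (m * L) * (m * L) ≤ m ^ 3 * n
cube-≤-m³n {m} {L} {n} L³≤n = begin
  m * L * (m * L) * (m * L)      ≡⟨ solve (m ∷ L ∷ []) ⟩
  m * (m * (m * 1)) * (L * L * L) ≤⟨ *-monoʳ-≤ (m * (m * (m * 1))) L³≤n ⟩
  m * (m * (m * 1)) * n           ∎

-- Sparse and dense graphs

sparse-certificate : ∀ {t n m r} (G : BipGraph m n) → ¬ ContainsC4 G → m * m ≤ t * t * t * t * n →
  t * t * t * t * (n * n * n) * (m * m) < suc r * suc r * (suc r * suc r) → edges m n G ≤ n + r
sparse-certificate {t} {n} {m} {r} G noC4 m²≤t⁴n Y<σ⁴ =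
  edges-≤-quadratic {e} {n} {n * (m * m)} {r} (subst (e * e ≤_) (*-distribˡ-+ n e (m * m)) (C4-free⇒edges² G noC4))
    (sparse-nm²<σ² {t} {n} {m} {suc r} m²≤t⁴n Y<σ⁴)
  where e = edges m n G

dense-threshold : ∀ {t n m ρ r} → 2 ≤ t → 65536 ≤ n → 1 ≤ m → m ≤ n → t * t * t * t * n < m * m →
  ρ * ρ * ρ ≤ (t ∸ 1) * (m * m) * (n * n) → (t ∸ 1) * (m * m) * (n * n) < suc ρ * suc ρ * suc ρ →
  t * t * t * t * (n * n * n) * (m * m) < suc r * suc r * (suc r * suc r) →
  ∃[ w ] w * r ≤ 2 * suc ρ × 2 * suc ρ < suc w * r × 4 * n * suc ρ + 2 * r ≤ r * r × suc w * suc w * suc w ≤ n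
dense-threshold {t} {n} {m} {ρ} {r} 2≤t 65536≤n 1≤m m≤n t⁴n<m² ρ³≤X X<R³ Y<σ⁴ =
  w , wr≤2R , 2R<[1+w]r , 4nR+2r≤r² ,
  cube-≤-of-scaled {suc w} {r} {n} {2 * suc ρ + r} 1≤r [1+w]r≤2R+r
    (dense-[2R+r]³≤nr³ {n} {ρ} {r} (≤-trans (m≤m+n 8 65528) 65536≤n) 1≤ρ
      (dense-512ρ³≤nr³ {t} {n} {m} {t ∸ 1} {ρ} {r} (≤-trans (s≤s z≤n) 2≤t) (m∸n≤m t 1) 65536≤n m≤n 1≤r ρ³≤X Y<σ⁴))
  where
  1≤n : 1 ≤ n
  1≤n = ≤-trans 1≤m m≤n
  1≤X : 1 ≤ (t ∸ 1) * (m * m) * (n * n)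
  1≤X = *-mono-≤ (*-mono-≤ (∸-monoˡ-≤ 1 2≤t) (*-mono-≤ 1≤m 1≤m)) (*-mono-≤ 1≤n 1≤n)
  1≤ρ : 1 ≤ ρ
  1≤ρ = s≤s⁻¹ (mono-cancel-< (λ x → x * x * x) cube-mono-≤ (≤-<-trans 1≤X X<R³))
  4n<σ : 4 * n < suc r
  4n<σ = dense-4n<σ {t} {n} {m} {suc r} 2≤t t⁴n<m² Y<σ⁴
  1≤r : 1 ≤ r
  1≤r = ≤-trans (*-mono-≤ {1} {4} (s≤s z≤n) 1≤n) (s≤s⁻¹ 4n<σ)
  instance
    r≢0 : NonZero r
    r≢0 = >-nonZero 1≤r
  w = 2 * suc ρ / r
  wr≤2R : w * r ≤ 2 * suc ρ
  wr≤2R = proj₁ (/-bracket (2 * suc ρ) r)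
  2R<[1+w]r : 2 * suc ρ < suc w * r
  2R<[1+w]r = proj₂ (/-bracket (2 * suc ρ) r)
  [1+w]r≤2R+r : suc w * r ≤ 2 * suc ρ + r
  [1+w]r≤2R+r = ≤-trans (+-monoʳ-≤ r wr≤2R) (≤-reflexive (+-comm r (2 * suc ρ)))
  4nR+2r≤r² : 4 * n * suc ρ + 2 * r ≤ r * r
  4nR+2r≤r² = dense-4nR+2r≤r² {n} {ρ} {r} (≤-trans (m≤m+n 6 65530) 65536≤n) 4n<σ
                (dense-5nρ≤σ² {t} {n} {m} {t ∸ 1} {ρ} {suc r} 2≤t (m∸n≤m t 1) t⁴n<m² ρ³≤X Y<σ⁴)

dense-certificate : ∀ {t n m ρ r} (G : BipGraph m n) → ¬ ContainsC4 G → ¬ ContainsTheta3 t G →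
  2 ≤ t → 65536 ≤ n → 1 ≤ m → m ≤ n → t * t * t * t * n < m * m →
  ρ * ρ * ρ ≤ (t ∸ 1) * (m * m) * (n * n) → (t ∸ 1) * (m * m) * (n * n) < suc ρ * suc ρ * suc ρ →
  t * t * t * t * (n * n * n) * (m * m) < suc r * suc r * (suc r * suc r) →
  ∃[ L ] edges m n G ≤ ρ + r + m * L + n × L * L * L ≤ n
dense-certificate {t} {n} {m} {ρ} {r} G noC4 noθ 2≤t 65536≤n 1≤m m≤n t⁴n<m² ρ³≤X X<R³ Y<σ⁴ =
  let w , wr≤2R , 2R<Lr , 4nR+2r≤r² , L³≤n = dense-threshold {t} {n} {m} {ρ} {r} 2≤t 65536≤n 1≤m m≤n t⁴n<m² ρ³≤X X<R³ Y<σ⁴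
      L = suc w
      H = heavyPart G L
      heavy-bound = heavy-edges-bound {G = G} {H} {L} {suc ρ} {t ∸ 1} (s≤s z≤n) (∸-monoˡ-≤ 1 2≤t) 1≤m m≤n (<⇒≤ X<R³)
                      (λ u v → <⇒≤pred (pathCount-< noC4 noθ u v)) (heavyPart-⊆ G L) (heavyPart-heavy G L)
  in L , dense-edges-≤ {edges m n G} {edges m n H} {m} {n} {w} {ρ} {r} (edges-≤-heavyPart G L) heavy-bound 2R<Lr wr≤2R 4nR+2r≤r² , L³≤n

edges-certificate : ∀ {t n m ρ r} (G : BipGraph m n) → ¬ ContainsC4 G → ¬ ContainsTheta3 t G →
  2 ≤ t → 65536 ≤ n → 1 ≤ m → m ≤ n →
  ρ * ρ * ρ ≤ (t ∸ 1) * (m * m) * (n * n) → (t ∸ 1) * (m * m) * (n * n) < suc ρ * suc ρ * suc ρ →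
  t * t * t * t * (n * n * n) * (m * m) < suc r * suc r * (suc r * suc r) →
  ∃[ c ] edges m n G ≤ ρ + r + c + n × c * c * c ≤ m ^ 3 * n
edges-certificate {t} {n} {m} {ρ} {r} G noC4 noθ 2≤t 65536≤n 1≤m m≤n ρ³≤X X<R³ Y<σ⁴ with m * m ≤? t * t * t * t * n
... | yes sparse = 0 , ≤-trans (sparse-certificate {t} {n} {m} {r} G noC4 sparse Y<σ⁴) n+r≤ρ+r+0+n , z≤n
  where
  n+r≤ρ+r+0+n : n + r ≤ ρ + r + 0 + n
  n+r≤ρ+r+0+n = ≤-trans (m≤n+m (n + r) ρ) (≤-reflexive (solve (ρ ∷ n ∷ r ∷ [])))
... | no  dense =
  let L , e≤ρ+r+mL+n , L³≤n = dense-certificate {t} {n} {m} {ρ} {r} G noC4 noθ 2≤t 65536≤n 1≤m m≤n (≰⇒> dense) ρ³≤X X<R³ Y<σ⁴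
  in m * L , e≤ρ+r+mL+n , cube-≤-m³n {m} {L} {n} L³≤n

theorem5p1 : (t : ℕ) → 2 ≤ t → (k : ℕ) →
    Σ ℕ λ N → (n m : ℕ) → n ≥ N → 1 ≤ m → m ≤ n →
      (G : BipGraph m n) → ¬ ContainsC4 G → ¬ ContainsTheta3 t G →
      BoundHolds t k m n (edges m n G)
theorem5p1 t 2≤t k = 65536 , λ n m 65536≤n 1≤m m≤n G noC4 noθ →
  let X = (t ∸ 1) * (m * m) * (n * n)
      Y = t ^ 4 * n ^ 3 * m ^ 2
      K+1 = suc (suc k)
      ρ , ρ³≤X , X<R³ = root-bracket (λ x → x * x * x) X z≤n n≤n*n*n
      r , rK⁴≤Z , Z<σK⁴ = root-bracket (λ x → x * suc k * (x * suc k) * (x * suc k) * (x * suc k))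
                                        (K+1 * K+1 * K+1 * K+1 * Y) z≤n (n≤[n*K]⁴ k)
      Y<σ⁴ = subst (_< suc r * suc r * (suc r * suc r)) (Y-as-product t n m) (<-cancel-scaled-fourth {k} {Y} {suc r} Z<σK⁴)
      c , e≤ρ+r+c+n , c³≤m³n = edges-certificate {t} {n} {m} {ρ} {r} G noC4 noθ 2≤t 65536≤n 1≤m m≤n ρ³≤X X<R³ Y<σ⁴
  in BoundHolds-intro {t} {k} {m} {n} ρ r c e≤ρ+r+c+n ρ³≤X rK⁴≤Z c³≤m³n
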